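{- Let $d_1,d_2,d_3$ be positive integers with $3\mid d_1+d_2+d_3$, and let $S(d_1,d_2,d_3)$ be the vertex-disjoint union of stars with $d_1$, $d_2$ and $d_3$ edges. Then \[ R(S(d_1,d_2,d_3),\mathbb{Z}_3)=\begin{cases} d_1+d_2+d_3+5, & \text{if } d_1\equiv d_2\equiv d_3\equiv 1\pmod 3;\\ d_1+d_2+d_3+4, & \text{if } d_1\equiv d_2\equiv d_3\equiv 2\pmod 3;\\ d_1+d_2+d_3+3, & \text{if } d_1\equiv d_2\equiv d_3\equiv 0\pmod 3, \text{ or } \{d_1,d_2,d_3\} \text{ are congruent to } 0,1,2 \text{ in some order}.\end{cases} \]
   Context: For a graph $G$ with $3\mid e(G)$, $R(G,\mathbb{Z}_3)$ is the least integer $N$ such that for every edge-coloring $\chi: E(K_N)\to\mathbb{Z}_3$ there is a subgraph of $K_N$ isomorphic to $G$ whose edge colors sum to $0$ in $\mathbb{Z}_3$. -}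

module Defs where

open import Data.Nat using (ℕ; zero; suc; _+_; _<_; _%_)
open import Data.Fin using (Fin; zero; suc; toℕ)
open import Data.Fin.Base using (inject₁)
open import Data.List using (List; map; allFin; _++_)
open import Data.Nat.ListAction using (sum)
open import Data.Product using (_×_; _,_; Σ; ∃)
open import Data.Sum using (_⊎_; inj₁; inj₂)
open import Function.Definitions using (Injective)
open import Relation.Binary.PropositionalEquality using (_≡_)
open import Relation.Nullary using (¬_)

record Graph : Set₁ where
  field
    V : Set
    E : List (V × V)

-- An edge-colouring of K_N with colours in ℤ₃ = Fin 3: a colour for each
-- ordered pair, required to be symmetric (so it is a colouring of edges).
Coloring : ℕ → Set
Coloring N = Fin N → Fin N → Fin 3

Symmetric : ∀ {N} → Coloring N → Set
Symmetric {N} χ = ∀ (u v : Fin N) → χ u v ≡ χ v u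

-- A copy of G in K_N is an injective map of vertices; its image (with the
-- edges of G) is a subgraph of K_N isomorphic to G, and every such subgraph
-- arises this way.
ZeroSumCopy : (G : Graph) → ∀ {N} → Coloring N → Set
ZeroSumCopy G {N} χ =
  Σ (Graph.V G → Fin N) λ f →
    Injective _≡_ _≡_ f ×
    (sum (map (λ e → toℕ (χ (f (Data.Product.proj₁ e)) (f (Data.Product.proj₂ e))))
              (Graph.E G)) % 3 ≡ 0)

Arrows : Graph → ℕ → Set
Arrows G N = (χ : Coloring N) → Symmetric χ → ZeroSumCopy G χ

ZSRamseyIs : Graph → ℕ → Set
ZSRamseyIs G N = Arrows G N × (∀ M → M < N → ¬ Arrows G M)

starEdges : (d : ℕ) → List (Fin (suc d) × Fin (suc d))
starEdges d = map (λ i → (zero , suc i)) (allFin d)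

S : ℕ → ℕ → ℕ → Graph
S d₁ d₂ d₃ = record
  { V = Fin (suc d₁) ⊎ (Fin (suc d₂) ⊎ Fin (suc d₃))
  ; E = map (λ e → (inj₁ (Data.Product.proj₁ e) , inj₁ (Data.Product.proj₂ e))) (starEdges d₁)
     ++ map (λ e → (inj₂ (inj₁ (Data.Product.proj₁ e)) , inj₂ (inj₁ (Data.Product.proj₂ e)))) (starEdges d₂)
     ++ map (λ e → (inj₂ (inj₂ (Data.Product.proj₁ e)) , inj₂ (inj₂ (Data.Product.proj₂ e)))) (starEdges d₃)
  }

-- Colour K_M by w u + w v + 1 where the weight w is 2 on two vertices (all residues 1) or on one
-- vertex (all residues 2) and 0 elsewhere.  A star with d ≡ 1 edges then contributes the weights of its vertices
-- plus 1, so a copy has sum 2 · (number of heavy vertices used) (plus 2 for a heavy centre when d ≡ 2), never 0;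
-- and a copy avoiding all heavy vertices does not fit into the remaining M − 2 (resp. M − 1) vertices.  In the
-- last case the lower bound is just the number d₁ + d₂ + d₃ + 3 of vertices of S.
--
-- Suppose χ has no zero-sum copy.  Exchanging the images of two vertices of an embedding changes
-- its colour sum by an explicit Δ.  If Δ ≢ 0 for every embedding extending a partial embedding B, then all these
-- embeddings have sum Δ, the only s ∈ ℤ₃ with s ≢ 0 and s + Δ ≢ 0; so every other exchange inside the family
-- leaves the sum unchanged.  Such exchanges force χ to be constant off a few vertices, each of which sends a
-- single colour into the rest, and an explicit embedding built from this structure has sum 0.  The first family
-- comes from a cherry χ a b ≢ χ a c, which exists since a monochromatic χ gives a copy of sum (d₁ + d₂ + d₃) ρ = 0.

module Submission where

open import Defs
open import Data.Empty using (⊥; ⊥-elim)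
open import Data.Fin using (Fin; zero; suc; toℕ; join; splitAt; cast; fromℕ<; _↑ˡ_; _↑ʳ_)
open import Data.Fin.Properties
  using (all?; any?; toℕ-injective; suc-injective; splitAt-join; join-splitAt; toℕ-cast; toℕ-fromℕ<; injective⇒≤;
         splitAt-↑ˡ; splitAt-↑ʳ)
  renaming (_≟_ to _≟F_)
open import Data.List using (List; []; _∷_; map; tabulate; _++_; allFin; length; lookup)
open import Data.List.Properties using (map-++; map-∘; map-tabulate; map-cong)
open import Data.List.Relation.Unary.All using (All; []; _∷_)
import Data.List.Relation.Unary.All as All
open import Data.List.Relation.Unary.All.Properties using () renaming (++⁻ˡ to All-++⁻ˡ; ++⁻ʳ to All-++⁻ʳ)
open import Data.List.Relation.Unary.AllPairs using (AllPairs; []; _∷_)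
open import Data.List.Relation.Unary.AllPairs.Properties using () renaming (++⁺ to AllPairs-++⁺)
open import Data.Nat using (ℕ; zero; suc; _+_; _%_; _≤_; _<_; s≤s; z≤n) renaming (_≟_ to _≟ℕ_)
open import Data.Nat.Divisibility using (_∣_; n∣m⇒m%n≡0)
open import Data.Nat.DivMod using (%-distribˡ-+)
open import Data.Nat.ListAction using (sum)
open import Data.Nat.ListAction.Properties using (sum-++)
open import Data.Nat.Properties
  using (≤-trans; ≤-pred; n≤1+n; m≤n+m; <⇒≱; +-comm; +-assoc; +-identityʳ; +-mono-≤; +-monoˡ-≤)
open import Data.Nat.Tactic.RingSolver using (solve-∀)
open import Data.Product using (_×_; _,_; Σ; ∃; proj₁; proj₂)
open import Data.Sum using (_⊎_; inj₁; inj₂)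
import Data.Sum as Sum
open import Data.Unit using (⊤; tt)
open import Data.Vec.Functional using () renaming (_∷_ to _◂_)
open import Function using (_∘_; id; case_of_)
open import Function.Definitions using (Injective)
open import Relation.Binary.PropositionalEquality using (_≡_; _≢_; refl; sym; trans; cong; cong₂; subst)
open import Relation.Nullary using (¬_; Dec; yes; no; ¬?)
open import Relation.Nullary.Decidable using (True; toWitness; map′; _→-dec_; _×-dec_)

ℤ₃ : Set
ℤ₃ = Fin 3

pattern 0# = zero
pattern 1# = suc zero
pattern 2# = suc (suc zero)

infixl 6 _⊕_ _⊝_
infixl 7 _⊗_

_⊕_ : ℤ₃ → ℤ₃ → ℤ₃
0# ⊕ b = b
1# ⊕ 0# = 1#
1# ⊕ 1# = 2#
1# ⊕ 2# = 0#
2# ⊕ 0# = 2#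
2# ⊕ 1# = 0#
2# ⊕ 2# = 1#

neg : ℤ₃ → ℤ₃
neg 0# = 0#
neg 1# = 2#
neg 2# = 1#

_⊝_ : ℤ₃ → ℤ₃ → ℤ₃
a ⊝ b = a ⊕ neg b

_⊗_ : ℤ₃ → ℤ₃ → ℤ₃
0# ⊗ b = 0#
1# ⊗ b = b
2# ⊗ b = b ⊕ b

⟦_⟧ : ℕ → ℤ₃
⟦ zero ⟧ = 0#
⟦ suc n ⟧ = 1# ⊕ ⟦ n ⟧

exhaustive₁ : {P : ℤ₃ → Set} (P? : ∀ a → Dec (P a)) → {True (all? P?)} → ∀ a → P a
exhaustive₁ P? {t} = toWitness t

exhaustive₂ : {P : ℤ₃ → ℤ₃ → Set} (P? : ∀ a b → Dec (P a b)) → {True (all? λ a → all? (P? a))} → ∀ a b → P a b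
exhaustive₂ P? {t} = toWitness t

exhaustive₃ : {P : ℤ₃ → ℤ₃ → ℤ₃ → Set} (P? : ∀ a b c → Dec (P a b c)) →
              {True (all? λ a → all? λ b → all? (P? a b))} → ∀ a b c → P a b c
exhaustive₃ P? {t} = toWitness t

exhaustive₄ : {P : ℤ₃ → ℤ₃ → ℤ₃ → ℤ₃ → Set} (P? : ∀ a b c d → Dec (P a b c d)) →
              {True (all? λ a → all? λ b → all? λ c → all? (P? a b c))} → ∀ a b c d → P a b c d
exhaustive₄ P? {t} = toWitness t

exhaustive₅ : {P : ℤ₃ → ℤ₃ → ℤ₃ → ℤ₃ → ℤ₃ → Set} (P? : ∀ a b c d e → Dec (P a b c d e)) →
              {True (all? λ a → all? λ b → all? λ c → all? λ d → all? (P? a b c d))} → ∀ a b c d e → P a b c d e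
exhaustive₅ P? {t} = toWitness t

exhaustive₆ : {P : ℤ₃ → ℤ₃ → ℤ₃ → ℤ₃ → ℤ₃ → ℤ₃ → Set} (P? : ∀ a b c d e f → Dec (P a b c d e f)) →
              {True (all? λ a → all? λ b → all? λ c → all? λ d → all? λ e → all? (P? a b c d e))} →
              ∀ a b c d e f → P a b c d e f
exhaustive₆ P? {t} = toWitness t

⊕-comm : ∀ a b → a ⊕ b ≡ b ⊕ a
⊕-comm = exhaustive₂ λ a b → a ⊕ b ≟F b ⊕ a

⊕-assoc : ∀ a b c → a ⊕ b ⊕ c ≡ a ⊕ (b ⊕ c)
⊕-assoc = exhaustive₃ λ a b c → a ⊕ b ⊕ c ≟F a ⊕ (b ⊕ c)

⊕-identityʳ : ∀ a → a ⊕ 0# ≡ a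
⊕-identityʳ = exhaustive₁ λ a → a ⊕ 0# ≟F a

⊝-self : ∀ a → a ⊝ a ≡ 0#
⊝-self = exhaustive₁ λ a → a ⊝ a ≟F 0#

⊝≡0⇒≡ : ∀ a b → a ⊝ b ≡ 0# → a ≡ b
⊝≡0⇒≡ = exhaustive₂ λ a b → (a ⊝ b ≟F 0#) →-dec (a ≟F b)

toℕ-⊕ : ∀ a b → toℕ (a ⊕ b) ≡ (toℕ a + toℕ b) % 3
toℕ-⊕ 0# 0# = refl
toℕ-⊕ 0# 1# = refl
toℕ-⊕ 0# 2# = refl
toℕ-⊕ 1# 0# = refl
toℕ-⊕ 1# 1# = refl
toℕ-⊕ 1# 2# = refl
toℕ-⊕ 2# 0# = refl
toℕ-⊕ 2# 1# = refl
toℕ-⊕ 2# 2# = refl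

toℕ%3 : ∀ (a : ℤ₃) → toℕ a % 3 ≡ toℕ a
toℕ%3 0# = refl
toℕ%3 1# = refl
toℕ%3 2# = refl

toℕ≡0⇒≡0# : ∀ (a : ℤ₃) → toℕ a ≡ 0 → a ≡ 0#
toℕ≡0⇒≡0# 0# _ = refl

+-%3 : ∀ x y (a b : ℤ₃) → x % 3 ≡ toℕ a → y % 3 ≡ toℕ b → (x + y) % 3 ≡ toℕ (a ⊕ b)
+-%3 x y a b x≡a y≡b =
  trans (%-distribˡ-+ x y 3) (trans (cong₂ (λ u v → (u + v) % 3) x≡a y≡b) (sym (toℕ-⊕ a b)))

toℕ-⟦⟧ : ∀ n → toℕ ⟦ n ⟧ ≡ n % 3
toℕ-⟦⟧ zero = refl
toℕ-⟦⟧ (suc n) = sym (+-%3 1 n 1# ⟦ n ⟧ refl (sym (toℕ-⟦⟧ n)))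

⟦⟧-from%3 : ∀ n r → n % 3 ≡ toℕ r → ⟦ n ⟧ ≡ r
⟦⟧-from%3 n r e = toℕ-injective (trans (toℕ-⟦⟧ n) e)

⟦⟧-+ : ∀ m n → ⟦ m + n ⟧ ≡ ⟦ m ⟧ ⊕ ⟦ n ⟧
⟦⟧-+ zero n = refl
⟦⟧-+ (suc m) n = trans (cong (1# ⊕_) (⟦⟧-+ m n)) (sym (⊕-assoc 1# ⟦ m ⟧ ⟦ n ⟧))

∑ : ∀ {d} → (Fin d → ℤ₃) → ℤ₃
∑ {zero} f = 0#
∑ {suc d} f = f zero ⊕ ∑ (f ∘ suc)

∑-cong : ∀ {d} {f g : Fin d → ℤ₃} → (∀ j → f j ≡ g j) → ∑ f ≡ ∑ g
∑-cong {zero} e = refl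
∑-cong {suc d} e = cong₂ _⊕_ (e zero) (∑-cong (e ∘ suc))

∑-const : ∀ d a → ∑ {d} (λ _ → a) ≡ ⟦ d ⟧ ⊗ a
∑-const zero a = exhaustive₁ (λ a → 0# ≟F 0# ⊗ a) a
∑-const (suc d) a = trans (cong (a ⊕_) (∑-const d a)) (distrib ⟦ d ⟧ a)
  where
  distrib : ∀ x a → a ⊕ x ⊗ a ≡ (1# ⊕ x) ⊗ a
  distrib = exhaustive₂ λ x a → a ⊕ x ⊗ a ≟F (1# ⊕ x) ⊗ a

∑-all : ∀ {d} (f : Fin d → ℤ₃) a → (∀ j → f j ≡ a) → ∑ f ≡ ⟦ d ⟧ ⊗ a
∑-all {d} f a e = trans (∑-cong e) (∑-const d a)

∑-zeros : ∀ {d} (h : Fin d → ℤ₃) → (∀ j → h j ≡ 0#) → ∑ h ≡ 0#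
∑-zeros {zero} h _ = refl
∑-zeros {suc d} h h≡0 = cong₂ _⊕_ (h≡0 zero) (∑-zeros (h ∘ suc) (h≡0 ∘ suc))

∑-single : ∀ {d} (h : Fin d → ℤ₃) j₀ → (∀ j → j ≢ j₀ → h j ≡ 0#) → ∑ h ≡ h j₀
∑-single h zero h≡0 =
  trans (cong (h zero ⊕_) (∑-zeros (h ∘ suc) (λ j → h≡0 (suc j) λ ()))) (⊕-identityʳ (h zero))
∑-single h (suc j₀) h≡0 =
  trans (cong (_⊕ ∑ (h ∘ suc)) (h≡0 zero λ ())) (∑-single (h ∘ suc) j₀ (λ j j≢j₀ → h≡0 (suc j) (j≢j₀ ∘ suc-injective)))

∑-pair : ∀ {d} (h : Fin d → ℤ₃) {j₀ j₁} → j₀ ≢ j₁ → (∀ j → j ≢ j₀ → j ≢ j₁ → h j ≡ 0#) → ∑ h ≡ h j₀ ⊕ h j₁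
∑-pair h {zero} {zero} j₀≢j₁ _ = ⊥-elim (j₀≢j₁ refl)
∑-pair h {zero} {suc j₁} _ h≡0 =
  cong (h zero ⊕_) (∑-single (h ∘ suc) j₁ λ j j≢j₁ → h≡0 (suc j) (λ ()) (j≢j₁ ∘ suc-injective))
∑-pair h {suc j₀} {zero} _ h≡0 =
  trans (cong (h zero ⊕_) (∑-single (h ∘ suc) j₀ λ j j≢j₀ → h≡0 (suc j) (j≢j₀ ∘ suc-injective) (λ ())))
        (⊕-comm (h zero) (h (suc j₀)))
∑-pair h {suc j₀} {suc j₁} j₀≢j₁ h≡0 =
  trans (cong (_⊕ ∑ (h ∘ suc)) (h≡0 zero (λ ()) (λ ())))
        (∑-pair (h ∘ suc) (j₀≢j₁ ∘ cong suc) λ j j≢j₀ j≢j₁ → h≡0 (suc j) (j≢j₀ ∘ suc-injective) (j≢j₁ ∘ suc-injective))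

∑-difference : ∀ {d} (f g : Fin d → ℤ₃) → ∑ g ≡ ∑ f ⊕ ∑ (λ j → g j ⊝ f j)
∑-difference {zero} f g = refl
∑-difference {suc d} f g =
  trans (cong (g zero ⊕_) (∑-difference (f ∘ suc) (g ∘ suc))) (regroup (g zero) (f zero) (∑ (f ∘ suc)) _)
  where
  regroup : ∀ x y t u → x ⊕ (t ⊕ u) ≡ y ⊕ t ⊕ (x ⊝ y ⊕ u)
  regroup = exhaustive₄ λ x y t u → x ⊕ (t ⊕ u) ≟F y ⊕ t ⊕ (x ⊝ y ⊕ u)

≡⇒⊝≡0 : ∀ {a b} → a ≡ b → a ⊝ b ≡ 0#
≡⇒⊝≡0 {a} refl = ⊝-self a

∑-update : ∀ {d} (f g : Fin d → ℤ₃) j₀ → (∀ j → j ≢ j₀ → g j ≡ f j) → ∑ g ≡ ∑ f ⊕ (g j₀ ⊝ f j₀)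
∑-update f g j₀ e = trans (∑-difference f g) (cong (∑ f ⊕_) (∑-single _ j₀ λ j n → ≡⇒⊝≡0 (e j n)))

∑-update₂ : ∀ {d} (f g : Fin d → ℤ₃) {j₀ j₁} → j₀ ≢ j₁ → (∀ j → j ≢ j₀ → j ≢ j₁ → g j ≡ f j) →
            ∑ g ≡ ∑ f ⊕ ((g j₀ ⊝ f j₀) ⊕ (g j₁ ⊝ f j₁))
∑-update₂ f g j₀≢j₁ e = trans (∑-difference f g) (cong (∑ f ⊕_) (∑-pair _ j₀≢j₁ λ j n₀ n₁ → ≡⇒⊝≡0 (e j n₀ n₁)))

∑-except : ∀ {d} (f : Fin d → ℤ₃) a j₀ → (∀ j → j ≢ j₀ → f j ≡ a) → ∑ f ≡ ⟦ d ⟧ ⊗ a ⊕ (f j₀ ⊝ a)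
∑-except {d} f a j₀ e = trans (∑-update (λ _ → a) f j₀ e) (cong (_⊕ (f j₀ ⊝ a)) (∑-const d a))

∑-⊕ : ∀ {d} (f g : Fin d → ℤ₃) → ∑ (λ j → f j ⊕ g j) ≡ ∑ f ⊕ ∑ g
∑-⊕ {zero} f g = refl
∑-⊕ {suc d} f g =
  trans (cong (f zero ⊕ g zero ⊕_) (∑-⊕ (f ∘ suc) (g ∘ suc))) (interchange (f zero) (g zero) (∑ (f ∘ suc)) (∑ (g ∘ suc)))
  where
  interchange : ∀ a b c d → a ⊕ b ⊕ (c ⊕ d) ≡ a ⊕ c ⊕ (b ⊕ d)
  interchange = exhaustive₄ λ a b c d → a ⊕ b ⊕ (c ⊕ d) ≟F a ⊕ c ⊕ (b ⊕ d)

∑-⊗ : ∀ {d} a (f : Fin d → ℤ₃) → ∑ (λ j → a ⊗ f j) ≡ a ⊗ ∑ f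
∑-⊗ {zero} a f = exhaustive₁ (λ a → 0# ≟F a ⊗ 0#) a
∑-⊗ {suc d} a f = trans (cong (a ⊗ f zero ⊕_) (∑-⊗ a (f ∘ suc))) (distrib a (f zero) (∑ (f ∘ suc)))
  where
  distrib : ∀ a b c → a ⊗ b ⊕ a ⊗ c ≡ a ⊗ (b ⊕ c)
  distrib = exhaustive₃ λ a b c → a ⊗ b ⊕ a ⊗ c ≟F a ⊗ (b ⊕ c)

∑-split : ∀ m n (f : Fin (m + n) → ℤ₃) → ∑ f ≡ ∑ (λ i → f (i ↑ˡ n)) ⊕ ∑ (λ i → f (m ↑ʳ i))
∑-split zero n f = refl
∑-split (suc m) n f = trans (cong (f zero ⊕_) (∑-split m n (f ∘ suc))) (sym (⊕-assoc (f zero) _ _))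

sum-toℕ-%3 : ∀ {d} (g : Fin d → ℤ₃) → sum (map toℕ (tabulate g)) % 3 ≡ toℕ (∑ g)
sum-toℕ-%3 {zero} g = refl
sum-toℕ-%3 {suc d} g = +-%3 (toℕ (g zero)) _ (g zero) (∑ (g ∘ suc)) (toℕ%3 (g zero)) (sum-toℕ-%3 (g ∘ suc))


scaled-pred≡0⇒≡0 : ∀ t κ → t ≢ 1# → t ⊗ κ ⊕ (0# ⊝ κ) ≡ 0# → κ ≡ 0#
scaled-pred≡0⇒≡0 = exhaustive₂ λ t κ → ¬? (t ≟F 1#) →-dec ((t ⊗ κ ⊕ (0# ⊝ κ) ≟F 0#) →-dec (κ ≟F 0#))

∑-Fin3 : ∀ (g : Fin 3 → ℤ₃) {A B C} → A ≢ B → A ≢ C → B ≢ C → ∑ g ≡ g A ⊕ g B ⊕ g C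
∑-Fin3 g {A} {B} {C} A≢B A≢C B≢C =
  trans (permutation-invariant (g 0#) (g 1#) (g 2#) A B C A≢B A≢C B≢C)
        (cong₂ _⊕_ (cong₂ _⊕_ (tabulated A) (tabulated B)) (tabulated C))
  where
  entry : ℤ₃ → ℤ₃ → ℤ₃ → Fin 3 → ℤ₃
  entry x y z 0# = x
  entry x y z 1# = y
  entry x y z 2# = z
  tabulated : ∀ s → entry (g 0#) (g 1#) (g 2#) s ≡ g s
  tabulated 0# = refl
  tabulated 1# = refl
  tabulated 2# = refl
  permutation-invariant : ∀ x y z A B C → A ≢ B → A ≢ C → B ≢ C →
                          x ⊕ (y ⊕ (z ⊕ 0#)) ≡ entry x y z A ⊕ entry x y z B ⊕ entry x y z C
  permutation-invariant = exhaustive₆ λ x y z A B C → ¬? (A ≟F B) →-dec (¬? (A ≟F C) →-dec (¬? (B ≟F C) →-dec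
                            (x ⊕ (y ⊕ (z ⊕ 0#)) ≟F entry x y z A ⊕ entry x y z B ⊕ entry x y z C)))

module _ {A : Set} {P : A → Set} where

  at₀ : ∀ {x xs} → All P (x ∷ xs) → P x
  at₀ = All.head

  at₁ : ∀ {x y xs} → All P (x ∷ y ∷ xs) → P y
  at₁ = at₀ ∘ All.tail

  at₂ : ∀ {x y z xs} → All P (x ∷ y ∷ z ∷ xs) → P z
  at₂ = at₁ ∘ All.tail

  at₃ : ∀ {x y z w xs} → All P (x ∷ y ∷ z ∷ w ∷ xs) → P w
  at₃ = at₂ ∘ All.tail

  at₄ : ∀ {x y z w v xs} → All P (x ∷ y ∷ z ∷ w ∷ v ∷ xs) → P v
  at₄ = at₃ ∘ All.tail

<-weaken : ∀ {a b} → suc a < b → a < b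
<-weaken {a} = ≤-trans (n≤1+n (suc a))

Fresh : ∀ {N} → Fin N → List (Fin N) → Set
Fresh v L = All (v ≢_) L

occurrence : ∀ {N} (v : Fin N) L → ¬ Fresh v L → Σ (Fin (length L)) λ i → lookup L i ≡ v
occurrence v [] not-fresh = ⊥-elim (not-fresh [])
occurrence v (w ∷ L) not-fresh with v ≟F w
... | yes v≡w = zero , sym v≡w
... | no v≢w with occurrence v L (not-fresh ∘ (v≢w ∷_))
... | i , e = suc i , e

fresh : ∀ {N} (L : List (Fin N)) → length L < N → Σ (Fin N) λ v → Fresh v L
fresh L L-short with any? (λ v → All.all? (λ w → ¬? (v ≟F w)) L)
... | yes found = found
... | no none = ⊥-elim (<⇒≱ L-short (injective⇒≤ position-injective))
  where
  position : ∀ v → Σ (Fin (length L)) λ i → lookup L i ≡ v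
  position v = occurrence v L (λ v-fresh → none (v , v-fresh))
  position-injective : Injective _≡_ _≡_ (proj₁ ∘ position)
  position-injective {u} {v} e = trans (sym (proj₂ (position u))) (trans (cong (lookup L) e) (proj₂ (position v)))

module _ {N : ℕ} (χ : Coloring N) where

  LocallyConstant : (Fin N → Set) → Set
  LocallyConstant In = ∀ u v w → In u → In v → In w → u ≢ v → u ≢ w → v ≢ w → χ u v ≡ χ u w

  Monochromatic : (Fin N → Set) → ℤ₃ → Set
  Monochromatic In ρ = ∀ u v → In u → In v → u ≢ v → χ u v ≡ ρ

module _ {N} {χ : Coloring N} {In : Fin N → Set} (χ-sym : Symmetric χ) (lc : LocallyConstant χ In)
         {y₀ y₁} (y₀∈ : In y₀) (y₁∈ : In y₁) (y₀≢y₁ : y₀ ≢ y₁) where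

  private
    from-y₀ : ∀ v → In v → y₀ ≢ v → χ y₀ v ≡ χ y₀ y₁
    from-y₀ v v∈ y₀≢v with v ≟F y₁
    ... | yes refl = refl
    ... | no v≢y₁ = lc y₀ v y₁ y₀∈ v∈ y₁∈ y₀≢v y₀≢y₁ v≢y₁

  locallyConstant⇒monochromatic : Monochromatic χ In (χ y₀ y₁)
  locallyConstant⇒monochromatic u v u∈ v∈ u≢v with u ≟F y₀ | v ≟F y₀
  ... | yes refl | _ = from-y₀ v v∈ u≢v
  ... | no u≢y₀ | yes refl = trans (χ-sym u y₀) (from-y₀ u u∈ (u≢y₀ ∘ sym))
  ... | no u≢y₀ | no v≢y₀ =
    trans (lc u v y₀ u∈ v∈ y₀∈ u≢v u≢y₀ v≢y₀) (trans (χ-sym u y₀) (from-y₀ u u∈ (u≢y₀ ∘ sym)))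

any-function? : ∀ {m N} (P : (Fin m → Fin N) → Set) → (∀ g → Dec (P g)) →
                (∀ f g → (∀ i → f i ≡ g i) → P f → P g) → Dec (∃ P)
any-function? {zero} P P? P-ext with P? (λ ())
... | yes p = yes (_ , p)
... | no ¬p = no λ { (g , pg) → ¬p (P-ext g _ (λ ()) pg) }
any-function? {suc m} P P? P-ext
  with any? (λ a → any-function? (P ∘ (a ◂_)) (P? ∘ (a ◂_)) λ f g e → P-ext (a ◂ f) (a ◂ g) (◂-cong a e))
  where
  ◂-cong : ∀ a {f g : Fin m → _} → (∀ i → f i ≡ g i) → ∀ i → (a ◂ f) i ≡ (a ◂ g) i
  ◂-cong a e zero = refl
  ◂-cong a e (suc i) = e i
... | yes (a , g , pg) = yes (a ◂ g , pg)
... | no ¬p = no λ { (f , pf) → ¬p (f zero , f ∘ suc , P-ext f _ (λ { zero → refl ; (suc i) → refl }) pf) }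

∑-affine : ∀ {d} a c (b : Fin d → ℤ₃) → ∑ (λ j → a ⊕ b j ⊕ c) ≡ ⟦ d ⟧ ⊗ (a ⊕ c) ⊕ ∑ b
∑-affine {d} a c b =
  trans (∑-cong λ j → swap₂₃ a (b j) c) (trans (∑-⊕ (λ _ → a ⊕ c) b) (cong (_⊕ ∑ b) (∑-const d (a ⊕ c))))
  where
  swap₂₃ : ∀ a b c → a ⊕ b ⊕ c ≡ a ⊕ c ⊕ b
  swap₂₃ = exhaustive₃ λ a b c → a ⊕ b ⊕ c ≟F a ⊕ c ⊕ b

retraction⇒injective : ∀ {A B : Set} (f : A → B) (g : B → A) → (∀ x → g (f x) ≡ x) → Injective _≡_ _≡_ f
retraction⇒injective f g g∘f≡id {x} {y} fx≡fy = trans (sym (g∘f≡id x)) (trans (cong g fx≡fy) (g∘f≡id y))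

module Forest (d₁ d₂ d₃ : ℕ) where

  Vertex : Set
  Vertex = Graph.V (S d₁ d₂ d₃)

  deg : Fin 3 → ℕ
  deg 0# = d₁
  deg 1# = d₂
  deg 2# = d₃

  centreVertex : Fin 3 → Vertex
  centreVertex 0# = inj₁ zero
  centreVertex 1# = inj₂ (inj₁ zero)
  centreVertex 2# = inj₂ (inj₂ zero)

  leafVertex : (s : Fin 3) → Fin (deg s) → Vertex
  leafVertex 0# j = inj₁ (suc j)
  leafVertex 1# j = inj₂ (inj₁ (suc j))
  leafVertex 2# j = inj₂ (inj₂ (suc j))

  centreVertex-injective : Injective _≡_ _≡_ centreVertex
  centreVertex-injective {0#} {0#} _ = refl
  centreVertex-injective {1#} {1#} _ = refl
  centreVertex-injective {2#} {2#} _ = refl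
  centreVertex-injective {0#} {1#} ()
  centreVertex-injective {0#} {2#} ()
  centreVertex-injective {1#} {0#} ()
  centreVertex-injective {1#} {2#} ()
  centreVertex-injective {2#} {0#} ()
  centreVertex-injective {2#} {1#} ()

  order : ℕ
  order = suc d₁ + (suc d₂ + suc d₃)

  index : Vertex → Fin order
  index = join _ _ ∘ Sum.map₂ (join _ _)

  vertexAt : Fin order → Vertex
  vertexAt = Sum.map₂ (splitAt (suc d₂)) ∘ splitAt (suc d₁)

  vertexAt-index : ∀ v → vertexAt (index v) ≡ v
  vertexAt-index v = trans (cong (Sum.map₂ (splitAt (suc d₂))) (splitAt-join (suc d₁) _ (Sum.map₂ (join _ _) v))) (inner v)
    where
    inner : ∀ v → Sum.map₂ (splitAt (suc d₂)) (Sum.map₂ (join (suc d₂) (suc d₃)) v) ≡ v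
    inner (inj₁ x) = refl
    inner (inj₂ y) = cong inj₂ (splitAt-join (suc d₂) (suc d₃) y)

  index-vertexAt : ∀ i → index (vertexAt i) ≡ i
  index-vertexAt i = trans (inner (splitAt (suc d₁) i)) (join-splitAt (suc d₁) _ i)
    where
    inner : ∀ s → join (suc d₁) _ (Sum.map₂ (join (suc d₂) (suc d₃)) (Sum.map₂ (splitAt (suc d₂)) s)) ≡ join (suc d₁) _ s
    inner (inj₁ x) = refl
    inner (inj₂ y) = cong (join (suc d₁) _ ∘ inj₂) (join-splitAt (suc d₂) (suc d₃) y)

  injection⇒order≤ : ∀ {M} {f : Vertex → Fin M} → Injective _≡_ _≡_ f → order ≤ M
  injection⇒order≤ f-inj = injective⇒≤ (retraction⇒injective vertexAt index index-vertexAt ∘ f-inj)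

  preimage? : ∀ {M} (f : Vertex → Fin M) z → Dec (∃ λ v → f v ≡ z)
  preimage? f z with any? (λ i → f (vertexAt i) ≟F z)
  ... | yes (i , e) = yes (vertexAt i , e)
  ... | no none = no λ { (v , e) → none (index v , trans (cong f (vertexAt-index v)) e) }

  module _ {M} (χ : Coloring M) (f : Vertex → Fin M) where

    starColour : Fin 3 → ℤ₃
    starColour s = ∑ λ j → χ (f (centreVertex s)) (f (leafVertex s j))

    colourSum : ℤ₃
    colourSum = ∑ starColour

    edgeColour : Vertex × Vertex → ℕ
    edgeColour e = toℕ (χ (f (proj₁ e)) (f (proj₂ e)))

    private
      starAt : ∀ {d} → (Fin (suc d) → Vertex) → List (Vertex × Vertex)
      starAt {d} embed = map (λ e → embed (proj₁ e) , embed (proj₂ e)) (starEdges d)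

      star-%3 : ∀ {d} (embed : Fin (suc d) → Vertex) →
                sum (map edgeColour (starAt embed)) % 3 ≡
                toℕ (∑ λ j → χ (f (embed zero)) (f (embed (suc j))))
      star-%3 {d} embed = trans (cong (λ l → sum l % 3) as-tabulate) (sum-toℕ-%3 (λ j → χ (f (embed zero)) (f (embed (suc j)))))
        where
        as-tabulate : map edgeColour (starAt embed) ≡
                      map toℕ (tabulate λ j → χ (f (embed zero)) (f (embed (suc j))))
        as-tabulate = trans (sym (map-∘ (map (λ i → zero , suc i) (allFin d))))
                     (trans (sym (map-∘ (allFin d))) (trans (map-tabulate id _) (sym (map-tabulate _ toℕ))))

      ++-%3 : ∀ xs ys {a b} → sum (map edgeColour xs) % 3 ≡ toℕ a → sum (map edgeColour ys) % 3 ≡ toℕ b →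
              sum (map edgeColour (xs ++ ys)) % 3 ≡ toℕ (a ⊕ b)
      ++-%3 xs ys xs≡a ys≡b =
        trans (cong (λ l → sum l % 3) (map-++ edgeColour xs ys))
              (trans (cong (_% 3) (sum-++ (map edgeColour xs) (map edgeColour ys))) (+-%3 (sum (map edgeColour xs)) (sum (map edgeColour ys)) _ _ xs≡a ys≡b))

    edges-%3 : sum (map edgeColour (Graph.E (S d₁ d₂ d₃))) % 3 ≡ toℕ colourSum
    edges-%3 = ++-%3 (starAt inj₁) _ (star-%3 inj₁) (++-%3 (starAt (inj₂ ∘ inj₁)) (starAt (inj₂ ∘ inj₂)) (star-%3 (inj₂ ∘ inj₁))
                 (trans (star-%3 (inj₂ ∘ inj₂)) (cong toℕ (sym (⊕-identityʳ (starColour 2#))))))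

  zeroSumCopy : ∀ {M} (χ : Coloring M) {f} → Injective _≡_ _≡_ f → colourSum χ f ≡ 0# → ZeroSumCopy (S d₁ d₂ d₃) χ
  zeroSumCopy χ {f} f-inj sum≡0 = f , f-inj , trans (edges-%3 χ f) (cong toℕ sum≡0)

  zeroSumCopy⇒colourSum≡0 : ∀ {M} {χ : Coloring M} (copy : ZeroSumCopy (S d₁ d₂ d₃) χ) → colourSum χ (proj₁ copy) ≡ 0#
  zeroSumCopy⇒colourSum≡0 {χ = χ} (f , _ , edges≡0) = toℕ≡0⇒≡0# _ (trans (sym (edges-%3 χ f)) edges≡0)

  module _ {M} (χ : Coloring M) where

    private
      IsCopy : (Vertex → Fin M) → Set
      IsCopy f = Injective _≡_ _≡_ f × (sum (map (edgeColour χ f) (Graph.E (S d₁ d₂ d₃))) % 3 ≡ 0)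

      injective? : (f : Vertex → Fin M) → Dec (Injective _≡_ _≡_ f)
      injective? f with all? (λ i → all? λ j → (f (vertexAt i) ≟F f (vertexAt j)) →-dec (i ≟F j))
      ... | yes inj = yes λ {x} {y} e → retraction⇒injective index vertexAt vertexAt-index
                        (inj (index x) (index y) (trans (cong f (vertexAt-index x)) (trans e (sym (cong f (vertexAt-index y))))))
      ... | no ¬inj = no λ inj → ¬inj λ i j e → retraction⇒injective vertexAt index index-vertexAt (inj e)

      IsCopy-ext : ∀ {f g} → (∀ v → f v ≡ g v) → IsCopy f → IsCopy g
      IsCopy-ext {f} {g} e (f-inj , f-sum) =
        (λ {x} {y} gx≡gy → f-inj (trans (e x) (trans gx≡gy (sym (e y))))) ,
        trans (cong (λ l → sum l % 3) (sym (map-cong (λ x → cong₂ (λ u v → toℕ (χ u v)) (e (proj₁ x)) (e (proj₂ x))) (Graph.E (S d₁ d₂ d₃))))) f-sum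

    zeroSumCopy? : Dec (ZeroSumCopy (S d₁ d₂ d₃) χ)
    zeroSumCopy? with any-function? (IsCopy ∘ (_∘ index)) (λ g → injective? (g ∘ index) ×-dec (_ ≟ℕ 0))
                                    (λ g g′ e → IsCopy-ext (e ∘ index))
    ... | yes (g , copy) = yes (g ∘ index , copy)
    ... | no none = no λ { (f , copy) → none (f ∘ vertexAt , IsCopy-ext (λ v → cong f (sym (vertexAt-index v))) copy) }

  ∑V : (Vertex → ℤ₃) → ℤ₃
  ∑V h = ∑ (h ∘ vertexAt)

  ∑V-single : ∀ h v₀ → (∀ v → v ≢ v₀ → h v ≡ 0#) → ∑V h ≡ h v₀
  ∑V-single h v₀ h≡0 =
    trans (∑-single (h ∘ vertexAt) (index v₀) λ i i≢ → h≡0 (vertexAt i) λ e → i≢ (trans (sym (index-vertexAt i)) (cong index e)))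
          (cong h (vertexAt-index v₀))

  ∑V-pair : ∀ h {v₀ v₁} → v₀ ≢ v₁ → (∀ v → v ≢ v₀ → v ≢ v₁ → h v ≡ 0#) → ∑V h ≡ h v₀ ⊕ h v₁
  ∑V-pair h {v₀} {v₁} v₀≢v₁ h≡0 =
    trans (∑-pair (h ∘ vertexAt) (v₀≢v₁ ∘ retraction⇒injective index vertexAt vertexAt-index)
                  λ i i≢₀ i≢₁ → h≡0 (vertexAt i) (i≢₀ ∘ away i) (i≢₁ ∘ away i))
          (cong₂ _⊕_ (cong h (vertexAt-index v₀)) (cong h (vertexAt-index v₁)))
    where
    away : ∀ i {v} → vertexAt i ≡ v → i ≡ index v
    away i e = trans (sym (index-vertexAt i)) (cong index e)

  ∑V-stars : ∀ h → ∑V h ≡ ∑ λ s → h (centreVertex s) ⊕ ∑ (λ j → h (leafVertex s j))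
  ∑V-stars h =
    trans (∑-split (suc d₁) (suc d₂ + suc d₃) (h ∘ vertexAt))
      (cong₂ _⊕_ (∑-cong λ i → cong (h ∘ Sum.map₂ (splitAt (suc d₂))) (splitAt-↑ˡ (suc d₁) i (suc d₂ + suc d₃)))
        (trans (∑-cong λ i → cong (h ∘ Sum.map₂ (splitAt (suc d₂))) (splitAt-↑ʳ (suc d₁) (suc d₂ + suc d₃) i))
          (trans (∑-split (suc d₂) (suc d₃) (λ i → h (inj₂ (splitAt (suc d₂) i))))
            (cong₂ _⊕_ (∑-cong λ i → cong (h ∘ inj₂) (splitAt-↑ˡ (suc d₂) i (suc d₃)))
              (trans (∑-cong λ i → cong (h ∘ inj₂) (splitAt-↑ʳ (suc d₂) (suc d₃) i))
                     (sym (⊕-identityʳ _)))))))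

module LowerBounds (d₁ d₂ d₃ : ℕ) where

  open Forest d₁ d₂ d₃

  too-few-vertices : ∀ {M} → M < order → ¬ Arrows (S d₁ d₂ d₃) M
  too-few-vertices M<order arrows with arrows (λ _ _ → 0#) (λ _ _ → refl)
  ... | f , f-inj , _ = <⇒≱ M<order (injection⇒order≤ f-inj)

  avoid-zero : ∀ {M} {f : Vertex → Fin (suc M)} → Injective _≡_ _≡_ f → (∀ v → f v ≢ zero) →
               Σ (Vertex → Fin M) λ g → Injective _≡_ _≡_ g × (∀ v → f v ≡ suc (g v))
  avoid-zero {M} {f} f-inj avoids = g , g-inj , f≡suc∘g
    where
    predecessor : (w : Fin (suc M)) → w ≢ zero → Σ (Fin M) λ w′ → w ≡ suc w′
    predecessor zero w≢0 = ⊥-elim (w≢0 refl)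
    predecessor (suc w) _ = w , refl
    g : Vertex → Fin M
    g v = proj₁ (predecessor (f v) (avoids v))
    f≡suc∘g : ∀ v → f v ≡ suc (g v)
    f≡suc∘g v = proj₂ (predecessor (f v) (avoids v))
    g-inj : Injective _≡_ _≡_ g
    g-inj {x} {y} e = f-inj (trans (f≡suc∘g x) (trans (cong suc e) (sym (f≡suc∘g y))))

  module Weighted {M} (w : Fin M → ℤ₃) where

    weighted : Coloring M
    weighted u v = w u ⊕ w v ⊕ 1#

    weighted-sym : Symmetric weighted
    weighted-sym u v = cong (_⊕ 1#) (⊕-comm (w u) (w v))

    colourSum-weighted : ∀ f → colourSum weighted f ≡
                         ∑ λ s → ⟦ deg s ⟧ ⊗ (w (f (centreVertex s)) ⊕ 1#) ⊕ ∑ (λ j → w (f (leafVertex s j)))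
    colourSum-weighted f = ∑-cong λ s → ∑-affine (w (f (centreVertex s))) 1# (λ j → w (f (leafVertex s j)))

  module ResiduesOne (residue : ∀ s → ⟦ deg s ⟧ ≡ 1#) where

    weight : ∀ {M} → Fin (2 + M) → ℤ₃
    weight zero = 2#
    weight (suc zero) = 2#
    weight (suc (suc _)) = 0#

    weight-off : ∀ {M} (x : Fin (2 + M)) → x ≢ zero → x ≢ suc zero → weight x ≡ 0#
    weight-off zero x≢0 _ = ⊥-elim (x≢0 refl)
    weight-off (suc zero) _ x≢1 = ⊥-elim (x≢1 refl)
    weight-off (suc (suc _)) _ _ = refl

    open Weighted

    colourSum≡∑V : ∀ {M} (f : Vertex → Fin (2 + M)) → colourSum (weighted weight) f ≡ ∑V (weight ∘ f)
    colourSum≡∑V f =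
      trans (colourSum-weighted weight f)
        (trans (∑-cong λ s → cong (λ r → r ⊗ (weight (f (centreVertex s)) ⊕ 1#) ⊕ ∑ (λ j → weight (f (leafVertex s j))))
                                  (residue s))
          (trans (regroup (x 0#) (y 0#) (x 1#) (y 1#) (x 2#) (y 2#)) (sym (∑V-stars (weight ∘ f)))))
      where
      x : Fin 3 → ℤ₃
      x s = weight (f (centreVertex s))
      y : Fin 3 → ℤ₃
      y s = ∑ λ j → weight (f (leafVertex s j))
      regroup : ∀ x₀ y₀ x₁ y₁ x₂ y₂ →
                (x₀ ⊕ 1# ⊕ y₀) ⊕ ((x₁ ⊕ 1# ⊕ y₁) ⊕ ((x₂ ⊕ 1# ⊕ y₂) ⊕ 0#)) ≡ (x₀ ⊕ y₀) ⊕ ((x₁ ⊕ y₁) ⊕ ((x₂ ⊕ y₂) ⊕ 0#))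
      regroup = exhaustive₆ λ x₀ y₀ x₁ y₁ x₂ y₂ →
                (x₀ ⊕ 1# ⊕ y₀) ⊕ ((x₁ ⊕ 1# ⊕ y₁) ⊕ ((x₂ ⊕ 1# ⊕ y₂) ⊕ 0#)) ≟F (x₀ ⊕ y₀) ⊕ ((x₁ ⊕ y₁) ⊕ ((x₂ ⊕ y₂) ⊕ 0#))

    no-zeroSumCopy : ∀ {M} → M < order → ¬ ZeroSumCopy (S d₁ d₂ d₃) (weighted (weight {M}))
    no-zeroSumCopy M<order copy@(f , f-inj , _) = by-preimages (preimage? f zero) (preimage? f (suc zero))
      where
      ∑V≡0 : ∑V (weight ∘ f) ≡ 0#
      ∑V≡0 = trans (sym (colourSum≡∑V f)) (zeroSumCopy⇒colourSum≡0 {χ = weighted weight} copy)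
      by-preimages : Dec (∃ λ v → f v ≡ zero) → Dec (∃ λ v → f v ≡ suc zero) → ⊥
      by-preimages (yes (v₀ , e₀)) (yes (v₁ , e₁)) = case trans (sym (trans (∑V-pair (weight ∘ f) v₀≢v₁ off) (cong₂ _⊕_ (cong weight e₀) (cong weight e₁)))) ∑V≡0 of λ ()
        where
        v₀≢v₁ : v₀ ≢ v₁
        v₀≢v₁ refl = case trans (sym e₀) e₁ of λ ()
        off : ∀ v → v ≢ v₀ → v ≢ v₁ → weight (f v) ≡ 0#
        off v v≢v₀ v≢v₁ = weight-off (f v) (λ e → v≢v₀ (f-inj (trans e (sym e₀)))) (λ e → v≢v₁ (f-inj (trans e (sym e₁))))
      by-preimages (yes (v₀ , e₀)) (no ¬hit₁) = case trans (sym (trans (∑V-single (weight ∘ f) v₀ off) (cong weight e₀))) ∑V≡0 of λ ()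
        where
        off : ∀ v → v ≢ v₀ → weight (f v) ≡ 0#
        off v v≢v₀ = weight-off (f v) (λ e → v≢v₀ (f-inj (trans e (sym e₀)))) (λ e → ¬hit₁ (v , e))
      by-preimages (no ¬hit₀) (yes (v₁ , e₁)) = case trans (sym (trans (∑V-single (weight ∘ f) v₁ off) (cong weight e₁))) ∑V≡0 of λ ()
        where
        off : ∀ v → v ≢ v₁ → weight (f v) ≡ 0#
        off v v≢v₁ = weight-off (f v) (λ e → ¬hit₀ (v , e)) (λ e → v≢v₁ (f-inj (trans e (sym e₁))))
      by-preimages (no ¬hit₀) (no ¬hit₁) =
        let g , g-inj , f≡suc∘g = avoid-zero f-inj (λ v e → ¬hit₀ (v , e))
            h , h-inj , _ = avoid-zero g-inj (λ v e → ¬hit₁ (v , trans (f≡suc∘g v) (cong suc e)))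
        in <⇒≱ M<order (injection⇒order≤ h-inj)

    no-arrows : ∀ M → M < order + 2 → ¬ Arrows (S d₁ d₂ d₃) M
    no-arrows 0 _ = too-few-vertices (s≤s z≤n)
    no-arrows 1 _ = too-few-vertices (s≤s (≤-trans (s≤s z≤n) (m≤n+m _ d₁)))
    no-arrows (suc (suc M)) M+2<order+2 arrows =
      no-zeroSumCopy (≤-pred (≤-pred (subst (suc (suc (suc M)) ≤_) (+-comm order 2) M+2<order+2)))
                     (arrows (weighted weight) (weighted-sym weight))

  module ResiduesTwo (residue : ∀ s → ⟦ deg s ⟧ ≡ 2#) where

    weight : ∀ {M} → Fin (suc M) → ℤ₃
    weight zero = 2#
    weight (suc _) = 0#

    weight-off : ∀ {M} (x : Fin (suc M)) → x ≢ zero → weight x ≡ 0#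
    weight-off zero x≢0 = ⊥-elim (x≢0 refl)
    weight-off (suc _) _ = refl

    open Weighted

    colourSum≡∑V+centres : ∀ {M} (f : Vertex → Fin (suc M)) →
                           colourSum (weighted weight) f ≡ ∑V (weight ∘ f) ⊕ ∑ (λ s → weight (f (centreVertex s)))
    colourSum≡∑V+centres f =
      trans (colourSum-weighted weight f)
        (trans (∑-cong λ s → cong (λ r → r ⊗ (x s ⊕ 1#) ⊕ y s) (residue s))
          (trans (regroup (x 0#) (y 0#) (x 1#) (y 1#) (x 2#) (y 2#)) (cong (_⊕ ∑ x) (sym (∑V-stars (weight ∘ f))))))
      where
      x : Fin 3 → ℤ₃
      x s = weight (f (centreVertex s))
      y : Fin 3 → ℤ₃
      y s = ∑ λ j → weight (f (leafVertex s j))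
      regroup : ∀ x₀ y₀ x₁ y₁ x₂ y₂ →
                (2# ⊗ (x₀ ⊕ 1#) ⊕ y₀) ⊕ ((2# ⊗ (x₁ ⊕ 1#) ⊕ y₁) ⊕ ((2# ⊗ (x₂ ⊕ 1#) ⊕ y₂) ⊕ 0#)) ≡
                (x₀ ⊕ y₀) ⊕ ((x₁ ⊕ y₁) ⊕ ((x₂ ⊕ y₂) ⊕ 0#)) ⊕ (x₀ ⊕ (x₁ ⊕ (x₂ ⊕ 0#)))
      regroup = exhaustive₆ λ x₀ y₀ x₁ y₁ x₂ y₂ →
                (2# ⊗ (x₀ ⊕ 1#) ⊕ y₀) ⊕ ((2# ⊗ (x₁ ⊕ 1#) ⊕ y₁) ⊕ ((2# ⊗ (x₂ ⊕ 1#) ⊕ y₂) ⊕ 0#)) ≟F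
                (x₀ ⊕ y₀) ⊕ ((x₁ ⊕ y₁) ⊕ ((x₂ ⊕ y₂) ⊕ 0#)) ⊕ (x₀ ⊕ (x₁ ⊕ (x₂ ⊕ 0#)))

    -- At most one centre is sent to the heavy vertex.
    centres-weight≢1 : ∀ {M} {f : Vertex → Fin (suc M)} → Injective _≡_ _≡_ f → ∑ (λ s → weight (f (centreVertex s))) ≢ 1#
    centres-weight≢1 {f = f} f-inj with any? (λ s → f (centreVertex s) ≟F zero)
    ... | yes (s , e) = λ sum≡1 → case trans (sym (trans (∑-single _ s off) (cong weight e))) sum≡1 of λ ()
      where
      off : ∀ t → t ≢ s → weight (f (centreVertex t)) ≡ 0#
      off t t≢s = weight-off _ λ e′ → t≢s (centreVertex-injective (f-inj (trans e′ (sym e))))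
    ... | no none = λ sum≡1 → case trans (sym (∑-zeros _ λ s → weight-off _ λ e → none (s , e))) sum≡1 of λ ()

    no-zeroSumCopy : ∀ {M} → M < order → ¬ ZeroSumCopy (S d₁ d₂ d₃) (weighted (weight {M}))
    no-zeroSumCopy M<order copy@(f , f-inj , _) with preimage? f zero
    ... | yes (v₀ , e₀) = nonzero _ (centres-weight≢1 f-inj) (trans (sym (colourSum≡∑V+centres f)) (zeroSumCopy⇒colourSum≡0 {χ = weighted weight} copy))
      where
      ∑V≡2 : ∑V (weight ∘ f) ≡ 2#
      ∑V≡2 = trans (∑V-single (weight ∘ f) v₀ λ v v≢v₀ → weight-off (f v) λ e → v≢v₀ (f-inj (trans e (sym e₀)))) (cong weight e₀)
      nonzero : ∀ t → t ≢ 1# → ∑V (weight ∘ f) ⊕ t ≢ 0#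
      nonzero t t≢1 = subst (λ a → a ⊕ t ≢ 0#) (sym ∑V≡2) (2⊕t≢0 t t≢1)
        where
        2⊕t≢0 : ∀ t → t ≢ 1# → 2# ⊕ t ≢ 0#
        2⊕t≢0 = exhaustive₁ λ t → ¬? (t ≟F 1#) →-dec ¬? (2# ⊕ t ≟F 0#)
    ... | no ¬hit = <⇒≱ M<order (injection⇒order≤ (proj₁ (proj₂ (avoid-zero f-inj λ v e → ¬hit (v , e)))))

    no-arrows : ∀ M → M < order + 1 → ¬ Arrows (S d₁ d₂ d₃) M
    no-arrows 0 _ = too-few-vertices (s≤s z≤n)
    no-arrows (suc M) M+1<order+1 arrows =
      no-zeroSumCopy (≤-pred (subst (suc (suc M) ≤_) (+-comm order 1) M+1<order+1))
                     (arrows (weighted weight) (weighted-sym weight))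

module Embeddings (d₁ d₂ d₃ k N : ℕ) (order+k≡N : Forest.order d₁ d₂ d₃ + k ≡ N) (χ : Coloring N) (χ-sym : Symmetric χ)
            (residues-sum≡0 : ∑ (λ s → ⟦ Forest.deg d₁ d₂ d₃ s ⟧) ≡ 0#) where

  open Forest d₁ d₂ d₃ using (Vertex; deg; centreVertex; leafVertex; order; index; vertexAt; vertexAt-index; colourSum; zeroSumCopy)

  -- An embedding of S together with k spare vertices of K_N is an injection Slot → Fin N.
  data Slot : Set where
    centre : Fin 3 → Slot
    leaf : (s : Fin 3) → Fin (deg s) → Slot
    spare : Fin k → Slot

  leaf-star-injective : ∀ {s s′ j j′} → leaf s j ≡ leaf s′ j′ → s ≡ s′
  leaf-star-injective refl = refl

  leaf-index-injective : ∀ {s j j′} → leaf s j ≡ leaf s j′ → j ≡ j′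
  leaf-index-injective refl = refl

  centre-injective : ∀ {s s′} → centre s ≡ centre s′ → s ≡ s′
  centre-injective refl = refl

  spare-injective : ∀ {u u′} → spare u ≡ spare u′ → u ≡ u′
  spare-injective refl = refl

  centre≢leaf : ∀ {s t j} → centre s ≢ leaf t j
  centre≢leaf ()

  slot : Vertex → Slot
  slot (inj₁ zero) = centre 0#
  slot (inj₁ (suc j)) = leaf 0# j
  slot (inj₂ (inj₁ zero)) = centre 1#
  slot (inj₂ (inj₁ (suc j))) = leaf 1# j
  slot (inj₂ (inj₂ zero)) = centre 2#
  slot (inj₂ (inj₂ (suc j))) = leaf 2# j

  -- Spare slots are sent to a junk vertex.
  vertex : Slot → Vertex
  vertex (centre s) = centreVertex s
  vertex (leaf s j) = leafVertex s j
  vertex (spare _) = centreVertex 0#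

  vertex-slot : ∀ v → vertex (slot v) ≡ v
  vertex-slot (inj₁ zero) = refl
  vertex-slot (inj₁ (suc j)) = refl
  vertex-slot (inj₂ (inj₁ zero)) = refl
  vertex-slot (inj₂ (inj₁ (suc j))) = refl
  vertex-slot (inj₂ (inj₂ zero)) = refl
  vertex-slot (inj₂ (inj₂ (suc j))) = refl

  slot-centre : ∀ s → slot (centreVertex s) ≡ centre s
  slot-centre 0# = refl
  slot-centre 1# = refl
  slot-centre 2# = refl

  slot-leaf : ∀ s j → slot (leafVertex s j) ≡ leaf s j
  slot-leaf 0# j = refl
  slot-leaf 1# j = refl
  slot-leaf 2# j = refl

  position : Slot → Fin order ⊎ Fin k
  position (centre s) = inj₁ (index (centreVertex s))
  position (leaf s j) = inj₁ (index (leafVertex s j))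
  position (spare u) = inj₂ u

  slotAt : Fin order ⊎ Fin k → Slot
  slotAt (inj₁ i) = slot (vertexAt i)
  slotAt (inj₂ u) = spare u

  slotAt-position : ∀ x → slotAt (position x) ≡ x
  slotAt-position (centre s) = trans (cong slot (vertexAt-index (centreVertex s))) (slot-centre s)
  slotAt-position (leaf s j) = trans (cong slot (vertexAt-index (leafVertex s j))) (slot-leaf s j)
  slotAt-position (spare u) = refl

  base : Slot → Fin N
  base = cast order+k≡N ∘ join order k ∘ position

  base-injective : Injective _≡_ _≡_ base
  base-injective {x} {y} e =
    retraction⇒injective position slotAt slotAt-position
      (retraction⇒injective (join order k) (splitAt order) (splitAt-join order k)
        (toℕ-injective (trans (sym (toℕ-cast order+k≡N _)) (trans (cong toℕ e) (toℕ-cast order+k≡N _)))))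

  starSum : (Slot → Fin N) → Fin 3 → ℤ₃
  starSum φ s = ∑ λ j → χ (φ (centre s)) (φ (leaf s j))

  copySum : (Slot → Fin N) → ℤ₃
  copySum φ = ∑ (starSum φ)

  ZS : Set
  ZS = ZeroSumCopy (S d₁ d₂ d₃) χ

  zeroSumCopy-of : (φ : Slot → Fin N) → Injective _≡_ _≡_ φ → copySum φ ≡ 0# → ZS
  zeroSumCopy-of φ φ-inj copySum≡0 =
    zeroSumCopy χ (λ e → retraction⇒injective slot vertex vertex-slot (φ-inj e))
      (trans (∑-cong λ s → ∑-cong λ j → cong₂ (λ a b → χ (φ a) (φ b)) (slot-centre s) (slot-leaf s j)) copySum≡0)

  swap : Fin N → Fin N → Fin N → Fin N
  swap p q w with w ≟F p
  ... | yes _ = q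
  ... | no _ with w ≟F q
  ...   | yes _ = p
  ...   | no _ = w

  swap-left : ∀ p q → swap p q p ≡ q
  swap-left p q with p ≟F p
  ... | yes _ = refl
  ... | no p≢p = ⊥-elim (p≢p refl)

  swap-right : ∀ p q → swap p q q ≡ p
  swap-right p q with q ≟F p
  ... | yes q≡p = q≡p
  ... | no _ with q ≟F q
  ...   | yes _ = refl
  ...   | no q≢q = ⊥-elim (q≢q refl)

  swap-other : ∀ p q w → w ≢ p → w ≢ q → swap p q w ≡ w
  swap-other p q w w≢p w≢q with w ≟F p
  ... | yes w≡p = ⊥-elim (w≢p w≡p)
  ... | no _ with w ≟F q
  ...   | yes w≡q = ⊥-elim (w≢q w≡q)
  ...   | no _ = refl

  swap-involutive : ∀ p q w → swap p q (swap p q w) ≡ w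
  swap-involutive p q w with w ≟F p
  ... | yes w≡p = trans (swap-right p q) (sym w≡p)
  ... | no w≢p with w ≟F q
  ...   | yes w≡q = trans (swap-left p q) (sym w≡q)
  ...   | no w≢q = swap-other p q w w≢p w≢q

  swap-injective : ∀ p q → Injective _≡_ _≡_ (swap p q)
  swap-injective p q = retraction⇒injective (swap p q) (swap p q) (swap-involutive p q)

  Inj : (Slot → Fin N) → Set
  Inj φ = Injective _≡_ _≡_ φ

  exchange : (Slot → Fin N) → Slot → Slot → (Slot → Fin N)
  exchange φ a b = swap (φ a) (φ b) ∘ φ

  exchange-injective : ∀ φ a b → Inj φ → Inj (exchange φ a b)
  exchange-injective φ a b φ-inj = φ-inj ∘ swap-injective (φ a) (φ b)

  exchange-left : ∀ φ a b → exchange φ a b a ≡ φ b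
  exchange-left φ a b = swap-left (φ a) (φ b)

  exchange-right : ∀ φ a b → exchange φ a b b ≡ φ a
  exchange-right φ a b = swap-right (φ a) (φ b)

  exchange-other : ∀ φ a b x → Inj φ → x ≢ a → x ≢ b → exchange φ a b x ≡ φ x
  exchange-other φ a b x φ-inj x≢a x≢b = swap-other (φ a) (φ b) (φ x) (x≢a ∘ φ-inj) (x≢b ∘ φ-inj)

  place : (Slot → Fin N) → Slot → Fin N → (Slot → Fin N)
  place φ a v = swap v (φ a) ∘ φ

  place-injective : ∀ φ a v → Inj φ → Inj (place φ a v)
  place-injective φ a v φ-inj = φ-inj ∘ swap-injective v (φ a)

  place-here : ∀ φ a v → place φ a v a ≡ v
  place-here φ a v = swap-right v (φ a)

  place-elsewhere : ∀ φ a v x → Inj φ → φ x ≢ v → x ≢ a → place φ a v x ≡ φ x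
  place-elsewhere φ a v x φ-inj φx≢v x≢a = swap-other v (φ a) (φ x) φx≢v (x≢a ∘ φ-inj)

  Placement : Set
  Placement = Slot × Fin N

  placeList : (Slot → Fin N) → List Placement → (Slot → Fin N)
  placeList φ [] = φ
  placeList φ ((a , v) ∷ L) = place (placeList φ L) a v

  placeList-injective : ∀ φ L → Inj φ → Inj (placeList φ L)
  placeList-injective φ [] φ-inj = φ-inj
  placeList-injective φ ((a , v) ∷ L) φ-inj = place-injective _ a v (placeList-injective φ L φ-inj)

  Apart : Placement → Placement → Set
  Apart (a , v) (b , w) = (a ≢ b) × (v ≢ w)

  Agree : (Slot → Fin N) → List Placement → Set
  Agree φ L = All (λ p → φ (proj₁ p) ≡ proj₂ p) L

  placeList-agrees : ∀ φ L → Inj φ → AllPairs Apart L → Agree (placeList φ L) L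
  placeList-agrees φ [] _ [] = []
  placeList-agrees φ ((a , v) ∷ L) φ-inj (apart ∷ apart-L) =
    place-here (placeList φ L) a v ∷ still-agree L apart (placeList-agrees φ L φ-inj apart-L)
    where
    still-agree : ∀ L′ → All (Apart (a , v)) L′ → Agree (placeList φ L) L′ → Agree (place (placeList φ L) a v) L′
    still-agree [] [] [] = []
    still-agree ((b , w) ∷ L′) ((a≢b , v≢w) ∷ apart′) (e ∷ es) =
      trans (place-elsewhere (placeList φ L) a v b (placeList-injective φ L φ-inj) (λ e′ → v≢w (sym (trans (sym e) e′))) (a≢b ∘ sym)) e
      ∷ still-agree L′ apart′ es

  -- Abstract, so that unification never unfolds the iterated swaps.
  abstract
    realise : List Placement → (Slot → Fin N)
    realise L = placeList base L

    realise-injective : ∀ L → Inj (realise L)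
    realise-injective L = placeList-injective base L base-injective

    realise-agrees : ∀ L → AllPairs Apart L → Agree (realise L) L
    realise-agrees L apart = placeList-agrees base L base-injective apart

  agree-exchange : ∀ φ → Inj φ → ∀ a b B → All (λ q → proj₁ q ≢ a × proj₁ q ≢ b) B → Agree φ B → Agree (exchange φ a b) B
  agree-exchange φ φ-inj a b [] [] [] = []
  agree-exchange φ φ-inj a b (q ∷ B) ((≢a , ≢b) ∷ ns) (e ∷ es) =
    trans (exchange-other φ a b (proj₁ q) φ-inj ≢a ≢b) e ∷ agree-exchange φ φ-inj a b B ns es

  apartAll : ∀ x v B → All (λ q → proj₁ q ≢ x) B → Fresh v (map proj₂ B) → All (Apart (x , v)) B
  apartAll x v [] [] [] = []
  apartAll x v (q ∷ B) (≢x ∷ ≢xs) (fresh ∷ freshs) = (≢x ∘ sym , fresh) ∷ apartAll x v B ≢xs freshs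

  unplaced-fresh : ∀ φ → Inj φ → ∀ L → Agree φ L → ∀ x → All (λ q → proj₁ q ≢ x) L → Fresh (φ x) (map proj₂ L)
  unplaced-fresh φ φ-inj [] [] x [] = []
  unplaced-fresh φ φ-inj (q ∷ L) (e ∷ es) x (≢x ∷ ≢xs) = (λ e′ → ≢x (φ-inj (trans e (sym e′)))) ∷ unplaced-fresh φ φ-inj L es x ≢xs

  starSum-cong : ∀ φ ψ s → ψ (centre s) ≡ φ (centre s) → (∀ j → ψ (leaf s j) ≡ φ (leaf s j)) → starSum ψ s ≡ starSum φ s
  starSum-cong φ ψ s same-centre same-leaves = ∑-cong λ j → cong₂ χ same-centre (same-leaves j)

  starSum-leaf-moved : ∀ φ ψ i j₀ → ψ (centre i) ≡ φ (centre i) → (∀ j → j ≢ j₀ → ψ (leaf i j) ≡ φ (leaf i j)) →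
                       starSum ψ i ≡ starSum φ i ⊕ (χ (φ (centre i)) (ψ (leaf i j₀)) ⊝ χ (φ (centre i)) (φ (leaf i j₀)))
  starSum-leaf-moved φ ψ i j₀ same-centre same-leaves =
    trans (∑-cong λ j → cong (λ c → χ c (ψ (leaf i j))) same-centre)
          (∑-update (λ j → χ (φ (centre i)) (φ (leaf i j))) (λ j → χ (φ (centre i)) (ψ (leaf i j))) j₀
                    λ j j≢j₀ → cong (χ (φ (centre i))) (same-leaves j j≢j₀))

  private
    cancel : ∀ t δ → t ⊕ δ ⊝ t ≡ δ
    cancel = exhaustive₂ λ t δ → t ⊕ δ ⊝ t ≟F δ

  copySum-change₁ : ∀ φ ψ i {δ} → (∀ s → s ≢ i → starSum ψ s ≡ starSum φ s) → starSum ψ i ≡ starSum φ i ⊕ δ →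
                    copySum ψ ≡ copySum φ ⊕ δ
  copySum-change₁ φ ψ i {δ} same changed =
    trans (∑-update (starSum φ) (starSum ψ) i same)
          (cong (copySum φ ⊕_) (trans (cong (_⊝ starSum φ i) changed) (cancel (starSum φ i) δ)))

  copySum-change₂ : ∀ φ ψ {i i′ δ δ′} → i ≢ i′ → (∀ s → s ≢ i → s ≢ i′ → starSum ψ s ≡ starSum φ s) →
                    starSum ψ i ≡ starSum φ i ⊕ δ → starSum ψ i′ ≡ starSum φ i′ ⊕ δ′ → copySum ψ ≡ copySum φ ⊕ (δ ⊕ δ′)
  copySum-change₂ φ ψ {i} {i′} {δ} {δ′} i≢i′ same changed changed′ =
    trans (∑-update₂ (starSum φ) (starSum ψ) i≢i′ same)
          (cong (copySum φ ⊕_) (cong₂ _⊕_ (trans (cong (_⊝ starSum φ i) changed) (cancel (starSum φ i) δ))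
                                          (trans (cong (_⊝ starSum φ i′) changed′) (cancel (starSum φ i′) δ′))))

  copySum-leaf↔spare : ∀ φ → Inj φ → ∀ i j₀ u {c v w} → φ (centre i) ≡ c → φ (leaf i j₀) ≡ v → φ (spare u) ≡ w →
                       copySum (exchange φ (leaf i j₀) (spare u)) ≡ copySum φ ⊕ (χ c w ⊝ χ c v)
  copySum-leaf↔spare φ φ-inj i j₀ u refl refl refl =
    copySum-change₁ φ ψ i
      (λ s s≢i → starSum-cong φ ψ s (fixed (centre s) (λ ()) (λ ())) λ j → fixed (leaf s j) (s≢i ∘ leaf-star-injective) (λ ()))
      (trans (starSum-leaf-moved φ ψ i j₀ (fixed (centre i) (λ ()) (λ ())) λ j j≢j₀ → fixed (leaf i j) (j≢j₀ ∘ leaf-index-injective) (λ ()))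
             (cong (λ w → starSum φ i ⊕ (χ (φ (centre i)) w ⊝ χ (φ (centre i)) (φ (leaf i j₀)))) (exchange-left φ (leaf i j₀) (spare u))))
    where
    ψ = exchange φ (leaf i j₀) (spare u)
    fixed : ∀ x → x ≢ leaf i j₀ → x ≢ spare u → ψ x ≡ φ x
    fixed x = exchange-other φ (leaf i j₀) (spare u) x φ-inj

  copySum-leaf↔leaf : ∀ φ → Inj φ → ∀ i j₀ i′ j₁ → i ≢ i′ → ∀ {c v c′ v′} → φ (centre i) ≡ c → φ (leaf i j₀) ≡ v →
                      φ (centre i′) ≡ c′ → φ (leaf i′ j₁) ≡ v′ →
                      copySum (exchange φ (leaf i j₀) (leaf i′ j₁)) ≡ copySum φ ⊕ ((χ c v′ ⊝ χ c v) ⊕ (χ c′ v ⊝ χ c′ v′))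
  copySum-leaf↔leaf φ φ-inj i j₀ i′ j₁ i≢i′ refl refl refl refl =
    copySum-change₂ φ ψ i≢i′
      (λ s s≢i s≢i′ → starSum-cong φ ψ s (fixed (centre s) (λ ()) (λ ()))
                        λ j → fixed (leaf s j) (s≢i ∘ leaf-star-injective) (s≢i′ ∘ leaf-star-injective))
      (trans (starSum-leaf-moved φ ψ i j₀ (fixed (centre i) (λ ()) (λ ()))
                λ j j≢j₀ → fixed (leaf i j) (j≢j₀ ∘ leaf-index-injective) (i≢i′ ∘ leaf-star-injective))
             (cong (λ w → starSum φ i ⊕ (χ (φ (centre i)) w ⊝ χ (φ (centre i)) (φ (leaf i j₀))))
                   (exchange-left φ (leaf i j₀) (leaf i′ j₁))))
      (trans (starSum-leaf-moved φ ψ i′ j₁ (fixed (centre i′) (λ ()) (λ ()))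
                λ j j≢j₁ → fixed (leaf i′ j) (i≢i′ ∘ sym ∘ leaf-star-injective) (j≢j₁ ∘ leaf-index-injective))
             (cong (λ w → starSum φ i′ ⊕ (χ (φ (centre i′)) w ⊝ χ (φ (centre i′)) (φ (leaf i′ j₁))))
                   (exchange-right φ (leaf i j₀) (leaf i′ j₁))))
    where
    ψ = exchange φ (leaf i j₀) (leaf i′ j₁)
    fixed : ∀ x → x ≢ leaf i j₀ → x ≢ leaf i′ j₁ → ψ x ≡ φ x
    fixed x = exchange-other φ (leaf i j₀) (leaf i′ j₁) x φ-inj

  -- Every edge of star l but the exchanged one changes by κ, so the sum changes by (deg l − 1) κ.
  copySum-centre↔leaf : ∀ φ → Inj φ → ∀ l j₀ κ {c r} → φ (centre l) ≡ c → φ (leaf l j₀) ≡ r →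
                        (∀ j → j ≢ j₀ → χ r (φ (leaf l j)) ⊝ χ c (φ (leaf l j)) ≡ κ) →
                        copySum (exchange φ (centre l) (leaf l j₀)) ≡ copySum φ ⊕ (⟦ deg l ⟧ ⊗ κ ⊕ (0# ⊝ κ))
  copySum-centre↔leaf φ φ-inj l j₀ κ refl refl κ-diff =
    copySum-change₁ φ ψ l
      (λ s s≢l → starSum-cong φ ψ s (fixed (centre s) (s≢l ∘ centre-injective) (λ ()))
                   λ j → fixed (leaf s j) (λ ()) (s≢l ∘ leaf-star-injective))
      (trans (∑-difference (edge φ) (edge ψ)) (cong (starSum φ l ⊕_) (trans (∑-except _ κ j₀ change) (cong (λ z → ⟦ deg l ⟧ ⊗ κ ⊕ (z ⊝ κ)) unchanged))))
    where
    ψ = exchange φ (centre l) (leaf l j₀)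
    fixed : ∀ x → x ≢ centre l → x ≢ leaf l j₀ → ψ x ≡ φ x
    fixed x = exchange-other φ (centre l) (leaf l j₀) x φ-inj
    edge : (Slot → Fin N) → Fin (deg l) → ℤ₃
    edge φ j = χ (φ (centre l)) (φ (leaf l j))
    change : ∀ j → j ≢ j₀ → edge ψ j ⊝ edge φ j ≡ κ
    change j j≢j₀ rewrite exchange-left φ (centre l) (leaf l j₀) | fixed (leaf l j) (λ ()) (j≢j₀ ∘ leaf-index-injective) = κ-diff j j≢j₀
    unchanged : edge ψ j₀ ⊝ edge φ j₀ ≡ 0#
    unchanged rewrite exchange-left φ (centre l) (leaf l j₀) | exchange-right φ (centre l) (leaf l j₀) =
      ≡⇒⊝≡0 (χ-sym (φ (leaf l j₀)) (φ (centre l)))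

  record Extension (E B : List Placement) : Set where
    field
      φ : Slot → Fin N
      φ-inj : Inj φ
      agrees-E : Agree φ E
      agrees-B : Agree φ B

  extend : ∀ E {B} → AllPairs Apart E → AllPairs Apart B → All (λ e → All (Apart e) B) E → Extension E B
  extend E {B} apart-E apart-B apart-EB = record
    { φ = realise (E ++ B) ; φ-inj = realise-injective (E ++ B)
    ; agrees-E = All-++⁻ˡ E agrees ; agrees-B = All-++⁻ʳ E agrees }
    where
    agrees = realise-agrees (E ++ B) (AllPairs-++⁺ apart-E apart-B apart-EB)

  starSum-constant : ∀ φ s ρ → (∀ j → χ (φ (centre s)) (φ (leaf s j)) ≡ ρ) → starSum φ s ≡ ⟦ deg s ⟧ ⊗ ρ
  starSum-constant φ s ρ = ∑-all _ ρ

  starSum-relative-constant : ∀ φ s ρ → (∀ j → χ (φ (centre s)) (φ (leaf s j)) ≡ ρ) → starSum φ s ⊝ ⟦ deg s ⟧ ⊗ ρ ≡ 0#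
  starSum-relative-constant φ s ρ constant = ≡⇒⊝≡0 (starSum-constant φ s ρ constant)

  starSum-relative-except : ∀ φ s ρ j₀ → (∀ j → j ≢ j₀ → χ (φ (centre s)) (φ (leaf s j)) ≡ ρ) →
                            starSum φ s ⊝ ⟦ deg s ⟧ ⊗ ρ ≡ χ (φ (centre s)) (φ (leaf s j₀)) ⊝ ρ
  starSum-relative-except φ s ρ j₀ constant =
    trans (cong (_⊝ ⟦ deg s ⟧ ⊗ ρ) (∑-except _ ρ j₀ constant)) (cancel (⟦ deg s ⟧ ⊗ ρ) (χ (φ (centre s)) (φ (leaf s j₀)) ⊝ ρ))

  copySum-relative : ∀ φ ρ → copySum φ ≡ ∑ λ s → starSum φ s ⊝ ⟦ deg s ⟧ ⊗ ρ
  copySum-relative φ ρ =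
    trans (∑-difference (λ s → ⟦ deg s ⟧ ⊗ ρ) (starSum φ))
          (cong (_⊕ ∑ λ s → starSum φ s ⊝ ⟦ deg s ⟧ ⊗ ρ) (scaled ⟦ deg 0# ⟧ ⟦ deg 1# ⟧ ⟦ deg 2# ⟧ ρ residues-sum≡0))
    where
    scaled : ∀ x y z ρ → x ⊕ (y ⊕ (z ⊕ 0#)) ≡ 0# → x ⊗ ρ ⊕ (y ⊗ ρ ⊕ (z ⊗ ρ ⊕ 0#)) ≡ 0#
    scaled = exhaustive₄ λ x y z ρ → (x ⊕ (y ⊕ (z ⊕ 0#)) ≟F 0#) →-dec (x ⊗ ρ ⊕ (y ⊗ ρ ⊕ (z ⊗ ρ ⊕ 0#)) ≟F 0#)

  copySum-monochromatic : ∀ φ ρ → (∀ s j → χ (φ (centre s)) (φ (leaf s j)) ≡ ρ) → copySum φ ≡ 0#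
  copySum-monochromatic φ ρ constant =
    trans (copySum-relative φ ρ) (∑-zeros _ λ s → starSum-relative-constant φ s ρ (constant s))

  copySum-oneException : ∀ φ ρ s₀ j₀ → (∀ s → s ≢ s₀ → ∀ j → χ (φ (centre s)) (φ (leaf s j)) ≡ ρ) →
                         (∀ j → j ≢ j₀ → χ (φ (centre s₀)) (φ (leaf s₀ j)) ≡ ρ) →
                         copySum φ ≡ χ (φ (centre s₀)) (φ (leaf s₀ j₀)) ⊝ ρ
  copySum-oneException φ ρ s₀ j₀ others constant =
    trans (copySum-relative φ ρ)
      (trans (∑-single _ s₀ λ s s≢s₀ → starSum-relative-constant φ s ρ (others s s≢s₀)) (starSum-relative-except φ s₀ ρ j₀ constant))

  module NoZeroSum (¬zs : ¬ ZS) where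

    copySum≢0 : ∀ φ → Inj φ → copySum φ ≢ 0#
    copySum≢0 φ φ-inj = ¬zs ∘ zeroSumCopy-of φ φ-inj

    Rigid : List Placement → ℤ₃ → Set
    Rigid B K = ∀ φ → Inj φ → Agree φ B → copySum φ ≡ K

    -- In ℤ₃ the only value s with s ≢ 0 and s ⊕ Δ ≢ 0 is Δ itself.
    rigid-by : ∀ B {a b Δ} → Δ ≢ 0# → (∀ φ → Inj φ → Agree φ B → copySum (exchange φ a b) ≡ copySum φ ⊕ Δ) → Rigid B Δ
    rigid-by B {a} {b} {Δ} Δ≢0 change φ φ-inj agrees =
      forced (copySum φ) Δ Δ≢0 (copySum≢0 φ φ-inj)
        λ e → copySum≢0 (exchange φ a b) (exchange-injective φ a b φ-inj) (trans (change φ φ-inj agrees) e)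
      where
      forced : ∀ s Δ → Δ ≢ 0# → s ≢ 0# → s ⊕ Δ ≢ 0# → s ≡ Δ
      forced = exhaustive₂ λ s Δ → ¬? (Δ ≟F 0#) →-dec (¬? (s ≟F 0#) →-dec (¬? (s ⊕ Δ ≟F 0#) →-dec (s ≟F Δ)))

    rigid-exchange : ∀ {B K} → Rigid B K → ∀ φ → Inj φ → Agree φ B → ∀ {a b} → All (λ q → proj₁ q ≢ a × proj₁ q ≢ b) B →
                     ∀ {Δ} → copySum (exchange φ a b) ≡ copySum φ ⊕ Δ → Δ ≡ 0#
    rigid-exchange {B} {K} rigid φ φ-inj agrees {a} {b} untouched {Δ} change =
      absorbed K Δ (trans (sym (rigid (exchange φ a b) (exchange-injective φ a b φ-inj) (agree-exchange φ φ-inj a b B untouched agrees)))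
                          (trans change (cong (_⊕ Δ) (rigid φ φ-inj agrees))))
      where
      absorbed : ∀ K Δ → K ≡ K ⊕ Δ → Δ ≡ 0#
      absorbed = exhaustive₂ λ K Δ → (K ≟F K ⊕ Δ) →-dec (Δ ≟F 0#)

    record Uniform (In : Fin N → Set) (p : Fin N) : Set where
      field
        ρ α : ℤ₃
        mono : Monochromatic χ In ρ
        const : ∀ r → In r → χ p r ≡ α

    module Uniformity (B : List Placement) (apart-B : AllPairs Apart B) {K} (rigid : Rigid B K)
                      (i l : Fin 3) (i≢l : i ≢ l) (p : Fin N) (p-centre : ∀ φ → Agree φ B → φ (centre i) ≡ p)
                      (jᵢ : Fin (deg i)) (jₗ : Fin (deg l))
                      (leaf-free : All (λ q → proj₁ q ≢ leaf i jᵢ) B)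
                      (centre-free : All (λ q → proj₁ q ≢ centre l) B)
                      (star-free : ∀ j → All (λ q → proj₁ q ≢ leaf l j) B)
                      (residue≢1 : ⟦ deg l ⟧ ≢ 1#)
                      (room : 2 + length (map proj₂ B) < N) where

      Outside : Fin N → Set
      Outside v = Fresh v (map proj₂ B)

      -- Exchange leaf jᵢ of star i (at r′) with leaf jₗ of star l (centre c, leaf at r).
      p-difference : ∀ c r r′ → Outside c → Outside r → Outside r′ → c ≢ r → c ≢ r′ → r ≢ r′ →
                     χ p r ⊝ χ p r′ ≡ χ c r ⊝ χ c r′
      p-difference c r r′ c∉ r∉ r′∉ c≢r c≢r′ r≢r′ =
        balance (χ p r) (χ p r′) (χ c r′) (χ c r)
          (rigid-exchange rigid φ φ-inj agrees-B (All.zip (leaf-free , star-free jₗ))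
             (copySum-leaf↔leaf φ φ-inj i jᵢ l jₗ i≢l (p-centre φ agrees-B) (at₂ agrees-E) (at₀ agrees-E) (at₁ agrees-E)))
        where
        E : List Placement
        E = (centre l , c) ∷ (leaf l jₗ , r) ∷ (leaf i jᵢ , r′) ∷ []
        open Extension (extend E
          ((((λ ()) , c≢r) ∷ ((λ ()) , c≢r′) ∷ []) ∷ (((i≢l ∘ sym ∘ leaf-star-injective) , r≢r′) ∷ []) ∷ [] ∷ [])
          apart-B
          (apartAll _ _ B centre-free c∉ ∷ apartAll _ _ B (star-free jₗ) r∉ ∷ apartAll _ _ B leaf-free r′∉ ∷ []))
        balance : ∀ a b c′ d → (a ⊝ b) ⊕ (c′ ⊝ d) ≡ 0# → a ⊝ b ≡ d ⊝ c′
        balance = exhaustive₄ λ a b c′ d → ((a ⊝ b) ⊕ (c′ ⊝ d) ≟F 0#) →-dec (a ⊝ b ≟F d ⊝ c′)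

      difference-independent : ∀ c r m m₀ → Outside c → Outside r → Outside m → Outside m₀ →
                               c ≢ r → c ≢ m → c ≢ m₀ → r ≢ m → r ≢ m₀ → χ r m ⊝ χ c m ≡ χ r m₀ ⊝ χ c m₀
      difference-independent c r m m₀ c∉ r∉ m∉ m₀∉ c≢r c≢m c≢m₀ r≢m r≢m₀ with m ≟F m₀
      ... | yes refl = refl
      ... | no m≢m₀ = rearrange (χ p m ⊝ χ p m₀) (χ c m) (χ c m₀) (χ r m) (χ r m₀)
                        (p-difference c m m₀ c∉ m∉ m₀∉ c≢m c≢m₀ m≢m₀) (p-difference r m m₀ r∉ m∉ m₀∉ r≢m r≢m₀ m≢m₀)
        where
        rearrange : ∀ X e f g h → X ≡ e ⊝ f → X ≡ g ⊝ h → g ⊝ e ≡ h ⊝ f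
        rearrange = exhaustive₅ λ X e f g h → (X ≟F e ⊝ f) →-dec ((X ≟F g ⊝ h) →-dec (g ⊝ e ≟F h ⊝ f))

      -- Exchanging centre and leaf of star l changes the sum by (deg l − 1) κ, which must vanish.
      same-colour : ∀ c r m → Outside c → Outside r → Outside m → c ≢ r → c ≢ m → r ≢ m → χ r m ≡ χ c m
      same-colour c r m c∉ r∉ m∉ c≢r c≢m r≢m =
        ⊝≡0⇒≡ _ _ (scaled-pred≡0⇒≡0 ⟦ deg l ⟧ (χ r m ⊝ χ c m) residue≢1
          (rigid-exchange rigid φ φ-inj agrees-B (All.zip (centre-free , star-free jₗ))
             (copySum-centre↔leaf φ φ-inj l jₗ (χ r m ⊝ χ c m) (at₀ agrees-E) (at₁ agrees-E) κ-difference)))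
        where
        E : List Placement
        E = (centre l , c) ∷ (leaf l jₗ , r) ∷ []
        open Extension (extend E ((((λ ()) , c≢r) ∷ []) ∷ [] ∷ []) apart-B
                               (apartAll _ _ B centre-free c∉ ∷ apartAll _ _ B (star-free jₗ) r∉ ∷ []))
        κ-difference : ∀ j → j ≢ jₗ → χ r (φ (leaf l j)) ⊝ χ c (φ (leaf l j)) ≡ χ r m ⊝ χ c m
        κ-difference j j≢jₗ =
          difference-independent c r (φ (leaf l j)) m c∉ r∉ (unplaced-fresh φ φ-inj B agrees-B (leaf l j) (star-free j)) m∉ c≢r
            (λ e → centre≢leaf (φ-inj (trans (at₀ agrees-E) e))) c≢m
            (λ e → j≢jₗ (sym (leaf-index-injective (φ-inj (trans (at₁ agrees-E) e))))) r≢m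

      uniform : Uniform Outside p
      uniform = record { ρ = χ y₀ y₁ ; α = χ p y₀ ; mono = mono ; const = const }
        where
        y₀ = proj₁ (fresh (map proj₂ B) (<-weaken (<-weaken room)))
        y₀∉ : Outside y₀
        y₀∉ = proj₂ (fresh (map proj₂ B) (<-weaken (<-weaken room)))
        y₁-fresh = proj₂ (fresh (y₀ ∷ map proj₂ B) (<-weaken room))
        y₁ = proj₁ (fresh (y₀ ∷ map proj₂ B) (<-weaken room))
        mono : Monochromatic χ Outside (χ y₀ y₁)
        mono = locallyConstant⇒monochromatic χ-sym
                 (λ u v w u∉ v∉ w∉ u≢v u≢w v≢w → trans (χ-sym u v) (trans (same-colour w v u w∉ v∉ u∉ (v≢w ∘ sym) (u≢w ∘ sym) (u≢v ∘ sym)) (χ-sym w u)))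
                 y₀∉ (All.tail y₁-fresh) (at₀ y₁-fresh ∘ sym)
        const : ∀ r → Outside r → χ p r ≡ χ p y₀
        const r r∉ with r ≟F y₀
        ... | yes refl = refl
        ... | no r≢y₀ = ⊝≡0⇒≡ (χ p r) (χ p y₀)
                          (trans (p-difference c r y₀ (All.tail (All.tail c-fresh)) r∉ y₀∉ (at₀ c-fresh) (at₁ c-fresh) r≢y₀)
                            (trans (cong₂ _⊝_ (mono c r (All.tail (All.tail c-fresh)) r∉ (at₀ c-fresh))
                                              (mono c y₀ (All.tail (All.tail c-fresh)) y₀∉ (at₁ c-fresh)))
                                   (⊝-self (χ y₀ y₁))))
          where
          c = proj₁ (fresh (r ∷ y₀ ∷ map proj₂ B) room)
          c-fresh = proj₂ (fresh (r ∷ y₀ ∷ map proj₂ B) room)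

    monochromatic⇒⊥ : ∀ ρ → Monochromatic χ (λ _ → ⊤) ρ → ⊥
    monochromatic⇒⊥ ρ mono = copySum≢0 base base-injective
      (copySum-monochromatic base ρ λ s j → mono (base (centre s)) (base (leaf s j)) tt tt (centre≢leaf ∘ base-injective {centre s} {leaf s j}))

    Cherry : Set
    Cherry = Σ (Fin N) λ a → Σ (Fin N) λ b → Σ (Fin N) λ c → (a ≢ b) × (a ≢ c) × (b ≢ c) × (χ a b ≢ χ a c)

    -- Without a cherry χ would be monochromatic, and a monochromatic copy has sum (d₁ + d₂ + d₃) ρ = 0.
    cherry : Cherry
    cherry with any? (λ a → any? λ b → any? λ c → ¬? (a ≟F b) ×-dec (¬? (a ≟F c) ×-dec (¬? (b ≟F c) ×-dec ¬? (χ a b ≟F χ a c))))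
    ... | yes found = found
    ... | no none = ⊥-elim (monochromatic⇒⊥ _ (locallyConstant⇒monochromatic χ-sym locally {base (centre 0#)} {base (centre 1#)} tt tt
                                                 λ e → case centre-injective (base-injective {centre 0#} {centre 1#} e) of λ ()))
      where
      locally : LocallyConstant χ (λ _ → ⊤)
      locally u v w _ _ _ u≢v u≢w v≢w with χ u v ≟F χ u w
      ... | yes e = e
      ... | no n = ⊥-elim (none (u , v , w , u≢v , u≢w , v≢w , n))

    Off : Fin N → Fin N → Fin N → Fin N → Set
    Off a b c v = Fresh v (a ∷ b ∷ c ∷ [])

    cherryPlacement : Fin (deg 0#) → Fin k → Fin N → Fin N → Fin N → List Placement
    cherryPlacement j u a b c = (centre 0# , a) ∷ (leaf 0# j , b) ∷ (spare u , c) ∷ []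

    cherryPlacement-apart : ∀ {j u a b c} → a ≢ b → a ≢ c → b ≢ c → AllPairs Apart (cherryPlacement j u a b c)
    cherryPlacement-apart a≢b a≢c b≢c = (((λ ()) , a≢b) ∷ ((λ ()) , a≢c) ∷ []) ∷ (((λ ()) , b≢c) ∷ []) ∷ [] ∷ []

    cherry-rigid : ∀ j u {a b c} → χ a b ≢ χ a c → Rigid (cherryPlacement j u a b c) (χ a c ⊝ χ a b)
    cherry-rigid j u χab≢χac = rigid-by _ (λ e → χab≢χac (sym (⊝≡0⇒≡ _ _ e)))
      λ φ φ-inj agrees → copySum-leaf↔spare φ φ-inj 0# j u (at₀ agrees) (at₁ agrees) (at₂ agrees)

    module TwoSpares (u₀ u₁ : Fin k) (u₀≢u₁ : u₀ ≢ u₁) (firstLeaf : ∀ s → Fin (deg s)) (room : 5 < N) where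

      -- In the rigid family of the cherry, exchanging leaf and spare of star 1 (at y₁, y₂ around y) changes nothing.
      locallyConstant-off-cherry : ∀ {a b c} → a ≢ b → a ≢ c → b ≢ c → χ a b ≢ χ a c → LocallyConstant χ (Off a b c)
      locallyConstant-off-cherry {a} {b} {c} a≢b a≢c b≢c χab≢χac y y₁ y₂ y∉ y₁∉ y₂∉ y≢y₁ y≢y₂ y₁≢y₂ =
        sym (⊝≡0⇒≡ _ _ (rigid-exchange rigid φ φ-inj agrees-B untouched
          (copySum-leaf↔spare φ φ-inj 1# (firstLeaf 1#) u₁ (at₀ agrees-E) (at₁ agrees-E) (at₂ agrees-E))))
        where
        B = cherryPlacement (firstLeaf 0#) u₀ a b c
        rigid = cherry-rigid (firstLeaf 0#) u₀ χab≢χac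
        E : List Placement
        E = (centre 1# , y) ∷ (leaf 1# (firstLeaf 1#) , y₁) ∷ (spare u₁ , y₂) ∷ []
        open Extension (extend E
          ((((λ ()) , y≢y₁) ∷ ((λ ()) , y≢y₂) ∷ []) ∷ (((λ ()) , y₁≢y₂) ∷ []) ∷ [] ∷ [])
          (cherryPlacement-apart a≢b a≢c b≢c)
          ((((λ ()) , at₀ y∉) ∷ ((λ ()) , at₁ y∉) ∷ ((λ ()) , at₂ y∉) ∷ [])
           ∷ (((λ ()) , at₀ y₁∉) ∷ ((λ ()) , at₁ y₁∉) ∷ ((λ ()) , at₂ y₁∉) ∷ [])
           ∷ (((λ ()) , at₀ y₂∉) ∷ ((λ ()) , at₁ y₂∉) ∷ ((u₀≢u₁ ∘ sym ∘ spare-injective) , at₂ y₂∉) ∷ []) ∷ []))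
        untouched : All (λ q → proj₁ q ≢ leaf 1# (firstLeaf 1#) × proj₁ q ≢ spare u₁) B
        untouched = ((λ ()) , (λ ())) ∷ ((λ ()) , (λ ())) ∷ ((λ ()) , (u₀≢u₁ ∘ spare-injective)) ∷ []

      -- The copy centred at y with leaf z and all other vertices off {a, z, z′} has sum χ y z − ρ.
      leaf-colour≢ρ : ∀ {a z z′ ρ} → Monochromatic χ (Off a z z′) ρ → z ≢ a → z ≢ z′ → a ≢ z′ →
                      ∀ y → Off a z z′ y → χ y z ≢ ρ
      leaf-colour≢ρ {a} {z} {z′} {ρ} mono z≢a z≢z′ a≢z′ y y∉ χyz≡ρ =
        copySum≢0 φ φ-inj
          (trans (copySum-oneException φ ρ 0# (firstLeaf 0#) others star₀)
                 (trans (cong₂ (λ u v → χ u v ⊝ ρ) (at₀ agrees) (at₁ agrees)) (≡⇒⊝≡0 χyz≡ρ)))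
        where
        L : List Placement
        L = (centre 0# , y) ∷ (leaf 0# (firstLeaf 0#) , z) ∷ (spare u₀ , a) ∷ (spare u₁ , z′) ∷ []
        φ = realise L
        φ-inj = realise-injective L
        agrees = realise-agrees L
          ((((λ ()) , at₁ y∉) ∷ ((λ ()) , at₀ y∉) ∷ ((λ ()) , at₂ y∉) ∷ [])
           ∷ (((λ ()) , z≢a) ∷ ((λ ()) , z≢z′) ∷ []) ∷ (((u₀≢u₁ ∘ spare-injective) , a≢z′) ∷ []) ∷ [] ∷ [])
        off : ∀ x → All (λ q → proj₁ q ≢ x) L → Off a z z′ (φ x)
        off x free = let fr = unplaced-fresh φ φ-inj L agrees x free in at₂ fr ∷ at₁ fr ∷ at₃ fr ∷ []
        others : ∀ s → s ≢ 0# → ∀ j → χ (φ (centre s)) (φ (leaf s j)) ≡ ρ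
        others s s≢0 j = mono _ _ (off (centre s) ((s≢0 ∘ sym ∘ centre-injective) ∷ (λ ()) ∷ (λ ()) ∷ (λ ()) ∷ []))
                                  (off (leaf s j) ((λ ()) ∷ (s≢0 ∘ sym ∘ leaf-star-injective) ∷ (λ ()) ∷ (λ ()) ∷ []))
                                  (centre≢leaf ∘ φ-inj)
        star₀ : ∀ j → j ≢ firstLeaf 0# → χ (φ (centre 0#)) (φ (leaf 0# j)) ≡ ρ
        star₀ j j≢ rewrite at₀ agrees =
          mono y _ y∉ (off (leaf 0# j) free) (at₀ (unplaced-fresh φ φ-inj L agrees (leaf 0# j) free) ∘ sym)
          where
          free = (λ ()) ∷ (j≢ ∘ sym ∘ leaf-index-injective) ∷ (λ ()) ∷ (λ ()) ∷ []

      module Around (a b c : Fin N) (a≢b : a ≢ b) (a≢c : a ≢ c) (b≢c : b ≢ c) (χab≢χac : χ a b ≢ χ a c) where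

        y₀ : Fin N
        y₀ = proj₁ (fresh (a ∷ b ∷ c ∷ []) (<-weaken (<-weaken room)))
        y₀∉ : Off a b c y₀
        y₀∉ = proj₂ (fresh (a ∷ b ∷ c ∷ []) (<-weaken (<-weaken room)))
        y₁ : Fin N
        y₁ = proj₁ (fresh (y₀ ∷ a ∷ b ∷ c ∷ []) (<-weaken room))
        y₁-fresh : Fresh y₁ (y₀ ∷ a ∷ b ∷ c ∷ [])
        y₁-fresh = proj₂ (fresh (y₀ ∷ a ∷ b ∷ c ∷ []) (<-weaken room))
        y₂ : Fin N
        y₂ = proj₁ (fresh (y₁ ∷ y₀ ∷ a ∷ b ∷ c ∷ []) room)
        y₂-fresh : Fresh y₂ (y₁ ∷ y₀ ∷ a ∷ b ∷ c ∷ [])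
        y₂-fresh = proj₂ (fresh (y₁ ∷ y₀ ∷ a ∷ b ∷ c ∷ []) room)

        mono : Monochromatic χ (Off a b c) (χ y₀ y₁)
        mono = locallyConstant⇒monochromatic χ-sym (locallyConstant-off-cherry a≢b a≢c b≢c χab≢χac)
                 y₀∉ (All.tail y₁-fresh) (at₀ y₁-fresh ∘ sym)

        -- With (b′, c′) one of (b, c) and (c, b): the cherry (a, y₀, c′) forces χ y₁ b′ = χ y₁ y₂ = ρ.
        second-cherry : ∀ {b′ c′} → (∀ {v} → Off a b c v → Off a b′ c′ v) → (∀ {v} → Off a b′ c′ v → Off a b c v) →
                        a ≢ b′ → a ≢ c′ → b′ ≢ c′ → χ a y₀ ≢ χ a c′ → ⊥
        second-cherry {b′} {c′} to from a≢b′ a≢c′ b′≢c′ χay₀≢χac′ =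
          leaf-colour≢ρ (λ u v u∉ v∉ → mono u v (from u∉) (from v∉)) (a≢b′ ∘ sym) b′≢c′ a≢c′ y₁ y₁∉
            (trans (locallyConstant-off-cherry (at₀ y₀∉′ ∘ sym) a≢c′ (at₂ y₀∉′) χay₀≢χac′ y₁ b′ y₂
                      (at₀ y₁∉ ∷ at₀ y₁-fresh ∷ at₂ y₁∉ ∷ [])
                      ((a≢b′ ∘ sym) ∷ (at₁ y₀∉′ ∘ sym) ∷ b′≢c′ ∷ [])
                      (at₀ y₂∉ ∷ at₁ y₂-fresh ∷ at₂ y₂∉ ∷ [])
                      (at₁ y₁∉) (at₀ y₂-fresh ∘ sym) (at₁ y₂∉ ∘ sym))
                   (mono y₁ y₂ (All.tail y₁-fresh) (All.tail (All.tail y₂-fresh)) (at₀ y₂-fresh ∘ sym)))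
          where
          y₀∉′ = to y₀∉
          y₁∉ = to (All.tail y₁-fresh)
          y₂∉ = to (All.tail (All.tail y₂-fresh))

        impossible : ⊥
        impossible with χ a y₀ ≟F χ a c
        ... | no χay₀≢χac = second-cherry id id a≢b a≢c b≢c χay₀≢χac
        ... | yes χay₀≡χac = second-cherry swap₂₃ swap₂₃ a≢c a≢b (b≢c ∘ sym) λ e → χab≢χac (trans (sym e) χay₀≡χac)
          where
          swap₂₃ : ∀ {x y v} → Off a x y v → Off a y x v
          swap₂₃ v∉ = at₀ v∉ ∷ at₂ v∉ ∷ at₁ v∉ ∷ []

      impossible : ⊥
      impossible = let a , b , c , a≢b , a≢c , b≢c , χab≢χac = cherry in Around.impossible a b c a≢b a≢c b≢c χab≢χac

    centres-uniform⇒⊥ : ∀ (u : Fin k) z ρ (Good : Fin N → Set) → (∀ t → Good t → ∀ m → m ≢ z → m ≢ t → χ t m ≡ ρ) →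
                        ∀ {t₀ t₁ t₂} → Good t₀ → Good t₁ → Good t₂ →
                        z ≢ t₀ → z ≢ t₁ → z ≢ t₂ → t₀ ≢ t₁ → t₀ ≢ t₂ → t₁ ≢ t₂ → ⊥
    centres-uniform⇒⊥ u z ρ Good good {t₀} {t₁} {t₂} t₀-good t₁-good t₂-good z≢t₀ z≢t₁ z≢t₂ t₀≢t₁ t₀≢t₂ t₁≢t₂ =
      copySum≢0 φ φ-inj (copySum-monochromatic φ ρ star)
      where
      L : List Placement
      L = (spare u , z) ∷ (centre 0# , t₀) ∷ (centre 1# , t₁) ∷ (centre 2# , t₂) ∷ []
      φ = realise L
      φ-inj = realise-injective L
      agrees = realise-agrees L
        ((((λ ()) , z≢t₀) ∷ ((λ ()) , z≢t₁) ∷ ((λ ()) , z≢t₂) ∷ []) ∷ (((λ ()) , t₀≢t₁) ∷ ((λ ()) , t₀≢t₂) ∷ [])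
         ∷ (((λ ()) , t₁≢t₂) ∷ []) ∷ [] ∷ [])
      leaf∉ : ∀ s j → Fresh (φ (leaf s j)) (z ∷ t₀ ∷ t₁ ∷ t₂ ∷ [])
      leaf∉ s j = unplaced-fresh φ φ-inj L agrees (leaf s j) ((λ ()) ∷ (λ ()) ∷ (λ ()) ∷ (λ ()) ∷ [])
      star : ∀ s j → χ (φ (centre s)) (φ (leaf s j)) ≡ ρ
      star 0# j rewrite at₁ agrees = good t₀ t₀-good _ (at₀ (leaf∉ 0# j)) (at₁ (leaf∉ 0# j))
      star 1# j rewrite at₂ agrees = good t₁ t₁-good _ (at₀ (leaf∉ 1# j)) (at₂ (leaf∉ 1# j))
      star 2# j rewrite at₃ agrees = good t₂ t₂-good _ (at₀ (leaf∉ 2# j)) (at₃ (leaf∉ 2# j))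

    module OneSpare (u : Fin k) (firstLeaf : ∀ s → Fin (deg s)) (j₂ : Fin (deg 0#)) (j₂≢ : j₂ ≢ firstLeaf 0#)
                    (residue₁≢1 : ⟦ deg 1# ⟧ ≢ 1#) (room : 7 < N) where

      uniform-off-cherry : ∀ {a b c} → a ≢ b → a ≢ c → b ≢ c → χ a b ≢ χ a c → Uniform (Off a b c) a
      uniform-off-cherry {a} {b} {c} a≢b a≢c b≢c χab≢χac =
        Uniformity.uniform (cherryPlacement (firstLeaf 0#) u a b c) (cherryPlacement-apart a≢b a≢c b≢c)
          (cherry-rigid (firstLeaf 0#) u χab≢χac) 0# 1# (λ ()) a (λ φ agrees → at₀ agrees) j₂ (firstLeaf 1#)
          ((λ ()) ∷ (j₂≢ ∘ sym ∘ leaf-index-injective) ∷ (λ ()) ∷ []) ((λ ()) ∷ (λ ()) ∷ (λ ()) ∷ [])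
          (λ j → (λ ()) ∷ (λ ()) ∷ (λ ()) ∷ []) residue₁≢1 (<-weaken (<-weaken room))

      module Around (a b c : Fin N) (a≢b : a ≢ b) (a≢c : a ≢ c) (b≢c : b ≢ c) (χab≢χac : χ a b ≢ χ a c) where

        open Uniform (uniform-off-cherry a≢b a≢c b≢c χab≢χac) using (ρ; mono)

        -- A non-ρ edge from w ∈ {a, b} gives a cherry at y whose uniform region shows every vertex off
        -- {a, b, c, y, w, y′} to be ρ-coloured away from w.
        non-ρ-edge⇒⊥ : ∀ w → (∀ {v} → Off a b c v → v ≢ w) → ∀ {y} → Off a b c y → χ w y ≢ ρ → ⊥
        non-ρ-edge⇒⊥ w off≢w {y} y∉ χwy≢ρ =
          centres-uniform⇒⊥ u w ρ Good good (t₀∉ , t₀∉′) (t₁∉ , t₁∉′) (t₂∉ , t₂∉′)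
            (off≢w t₀∉ ∘ sym) (off≢w t₁∉ ∘ sym) (off≢w t₂∉ ∘ sym) (at₀ t₁-fresh ∘ sym) (at₁ t₂-fresh ∘ sym) (at₀ t₂-fresh ∘ sym)
          where
          y′-fresh = proj₂ (fresh (y ∷ a ∷ b ∷ c ∷ []) (<-weaken (<-weaken (<-weaken room))))
          y′ = proj₁ (fresh (y ∷ a ∷ b ∷ c ∷ []) (<-weaken (<-weaken (<-weaken room))))
          y′∉ : Off a b c y′
          y′∉ = All.tail y′-fresh
          y≢y′ : y ≢ y′
          y≢y′ = at₀ y′-fresh ∘ sym
          open Uniform (uniform-off-cherry (off≢w y∉) y≢y′ (off≢w y′∉ ∘ sym)
                         λ e → χwy≢ρ (trans (χ-sym w y) (trans e (mono y y′ y∉ y′∉ y≢y′))))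
            using () renaming (ρ to ρ′; mono to mono′)
          Good : Fin N → Set
          Good t = Off a b c t × Off y w y′ t
          t₀-fresh = proj₂ (fresh (y ∷ y′ ∷ a ∷ b ∷ c ∷ []) (<-weaken (<-weaken room)))
          t₀ = proj₁ (fresh (y ∷ y′ ∷ a ∷ b ∷ c ∷ []) (<-weaken (<-weaken room)))
          t₁-fresh = proj₂ (fresh (t₀ ∷ y ∷ y′ ∷ a ∷ b ∷ c ∷ []) (<-weaken room))
          t₁ = proj₁ (fresh (t₀ ∷ y ∷ y′ ∷ a ∷ b ∷ c ∷ []) (<-weaken room))
          t₂-fresh = proj₂ (fresh (t₁ ∷ t₀ ∷ y ∷ y′ ∷ a ∷ b ∷ c ∷ []) room)
          t₂ = proj₁ (fresh (t₁ ∷ t₀ ∷ y ∷ y′ ∷ a ∷ b ∷ c ∷ []) room)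
          t₀∉ = All.tail (All.tail t₀-fresh)
          t₁∉ = All.tail (All.tail (All.tail t₁-fresh))
          t₂∉ = All.tail (All.tail (All.tail (All.tail t₂-fresh)))
          t₀∉′ : Off y w y′ t₀
          t₀∉′ = at₀ t₀-fresh ∷ off≢w t₀∉ ∷ at₁ t₀-fresh ∷ []
          t₁∉′ : Off y w y′ t₁
          t₁∉′ = at₁ t₁-fresh ∷ off≢w t₁∉ ∷ at₂ t₁-fresh ∷ []
          t₂∉′ : Off y w y′ t₂
          t₂∉′ = at₂ t₂-fresh ∷ off≢w t₂∉ ∷ at₃ t₂-fresh ∷ []
          ρ′≡ρ : ρ′ ≡ ρ
          ρ′≡ρ = trans (sym (mono′ t₀ t₁ t₀∉′ t₁∉′ (at₀ t₁-fresh ∘ sym))) (mono t₀ t₁ t₀∉ t₁∉ (at₀ t₁-fresh ∘ sym))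
          good : ∀ t → Good t → ∀ m → m ≢ w → m ≢ t → χ t m ≡ ρ
          good t (t∉ , t∉′) m m≢w m≢t with m ≟F y | m ≟F y′
          ... | yes refl | _ = mono t m t∉ y∉ (at₀ t∉′)
          ... | no _ | yes refl = mono t m t∉ y′∉ (at₂ t∉′)
          ... | no m≢y | no m≢y′ = trans (mono′ t m t∉′ (m≢y ∷ m≢w ∷ m≢y′ ∷ []) (m≢t ∘ sym)) ρ′≡ρ

        ρ-edges⇒⊥ : (∀ {y} → Off a b c y → χ a y ≡ ρ) → (∀ {y} → Off a b c y → χ b y ≡ ρ) → ⊥
        ρ-edges⇒⊥ a-edges b-edges =
          centres-uniform⇒⊥ u c ρ (Off a b c) good t₀∉ t₁∉ t₂∉
            (at₂ t₀∉ ∘ sym) (at₂ t₁∉ ∘ sym) (at₂ t₂∉ ∘ sym) (at₀ t₁-fresh ∘ sym) (at₁ t₂-fresh ∘ sym) (at₀ t₂-fresh ∘ sym)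
          where
          t₀∉ = proj₂ (fresh (a ∷ b ∷ c ∷ []) (<-weaken (<-weaken (<-weaken (<-weaken room)))))
          t₀ = proj₁ (fresh (a ∷ b ∷ c ∷ []) (<-weaken (<-weaken (<-weaken (<-weaken room)))))
          t₁-fresh = proj₂ (fresh (t₀ ∷ a ∷ b ∷ c ∷ []) (<-weaken (<-weaken (<-weaken room))))
          t₁ = proj₁ (fresh (t₀ ∷ a ∷ b ∷ c ∷ []) (<-weaken (<-weaken (<-weaken room))))
          t₂-fresh = proj₂ (fresh (t₁ ∷ t₀ ∷ a ∷ b ∷ c ∷ []) (<-weaken (<-weaken room)))
          t₁∉ = All.tail t₁-fresh
          t₂∉ = All.tail (All.tail t₂-fresh)
          good : ∀ t → Off a b c t → ∀ m → m ≢ c → m ≢ t → χ t m ≡ ρ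
          good t t∉ m m≢c m≢t with m ≟F a | m ≟F b
          ... | yes refl | _ = trans (χ-sym t m) (a-edges t∉)
          ... | no _ | yes refl = trans (χ-sym t m) (b-edges t∉)
          ... | no m≢a | no m≢b = mono t m t∉ (m≢a ∷ m≢b ∷ m≢c ∷ []) (m≢t ∘ sym)

        non-ρ-edge? : ∀ w → Dec (∃ λ y → Off a b c y × χ w y ≢ ρ)
        non-ρ-edge? w = any? λ y → All.all? (λ v → ¬? (y ≟F v)) (a ∷ b ∷ c ∷ []) ×-dec ¬? (χ w y ≟F ρ)

        ρ-edge : ∀ {w} → ¬ (∃ λ y → Off a b c y × χ w y ≢ ρ) → ∀ {y} → Off a b c y → χ w y ≡ ρ
        ρ-edge {w} none {y} y∉ with χ w y ≟F ρ
        ... | yes e = e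
        ... | no n = ⊥-elim (none (y , y∉ , n))

        impossible : ⊥
        impossible with non-ρ-edge? a | non-ρ-edge? b
        ... | yes (y , y∉ , χay≢ρ) | _ = non-ρ-edge⇒⊥ a (λ v∉ → at₀ v∉) y∉ χay≢ρ
        ... | no _ | yes (y , y∉ , χby≢ρ) = non-ρ-edge⇒⊥ b (λ v∉ → at₁ v∉) y∉ χby≢ρ
        ... | no none-a | no none-b = ρ-edges⇒⊥ (ρ-edge none-a) (ρ-edge none-b)

      impossible : ⊥
      impossible = let a , b , c , a≢b , a≢c , b≢c , χab≢χac = cherry in Around.impossible a b c a≢b a≢c b≢c χab≢χac


    defect : Fin N → Fin N → Fin N → Fin N → ℤ₃
    defect p q x y = (χ p y ⊝ χ p x) ⊕ (χ q x ⊝ χ q y)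

    defect-swap-stars : ∀ p q x y → defect q p y x ≡ defect p q x y
    defect-swap-stars p q x y = ⊕-comm (χ q x ⊝ χ q y) (χ p y ⊝ χ p x)

    defect-swap-roles : ∀ p q x y → defect x y p q ≡ defect p q x y
    defect-swap-roles p q x y rewrite χ-sym x q | χ-sym x p | χ-sym y p | χ-sym y q = regroup (χ p x) (χ q x) (χ p y) (χ q y)
      where
      regroup : ∀ a b c d → (b ⊝ a) ⊕ (c ⊝ d) ≡ (c ⊝ a) ⊕ (b ⊝ d)
      regroup = exhaustive₄ λ a b c d → (b ⊝ a) ⊕ (c ⊝ d) ≟F (c ⊝ a) ⊕ (b ⊝ d)

    defect-cocycle : ∀ p q x y r → defect p q x y ≡ defect p q x r ⊕ defect p q r y
    defect-cocycle p q x y r = regroup (χ p y) (χ p x) (χ q x) (χ q y) (χ p r) (χ q r)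
      where
      regroup : ∀ py px qx qy pr qr → (py ⊝ px) ⊕ (qx ⊝ qy) ≡ (pr ⊝ px) ⊕ (qx ⊝ qr) ⊕ ((py ⊝ pr) ⊕ (qr ⊝ qy))
      regroup = exhaustive₆ λ py px qx qy pr qr → (py ⊝ px) ⊕ (qx ⊝ qy) ≟F (pr ⊝ px) ⊕ (qx ⊝ qr) ⊕ ((py ⊝ pr) ⊕ (qr ⊝ qy))

    record Distinct₄ (p q x y : Fin N) : Set where
      field
        p≢q : p ≢ q
        p≢x : p ≢ x
        p≢y : p ≢ y
        q≢x : q ≢ x
        q≢y : q ≢ y
        x≢y : x ≢ y

    swap-stars : ∀ {p q x y} → Distinct₄ p q x y → Distinct₄ q p y x
    swap-stars d = record { p≢q = p≢q ∘ sym ; p≢x = q≢y ; p≢y = q≢x ; q≢x = p≢y ; q≢y = p≢x ; x≢y = x≢y ∘ sym }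
      where open Distinct₄ d

    swap-roles : ∀ {p q x y} → Distinct₄ p q x y → Distinct₄ x y p q
    swap-roles d = record { p≢q = x≢y ; p≢x = p≢x ∘ sym ; p≢y = q≢x ∘ sym ; q≢x = p≢y ∘ sym ; q≢y = q≢y ∘ sym ; x≢y = p≢q }
      where open Distinct₄ d

    distinct₄? : ∀ p q x y → Dec (Distinct₄ p q x y)
    distinct₄? p q x y =
      map′ (λ (p≢q , p≢x , p≢y , q≢x , q≢y , x≢y) → record { p≢q = p≢q ; p≢x = p≢x ; p≢y = p≢y ; q≢x = q≢x ; q≢y = q≢y ; x≢y = x≢y })
           (λ d → let open Distinct₄ d in p≢q , p≢x , p≢y , q≢x , q≢y , x≢y)
           (¬? (p ≟F q) ×-dec ¬? (p ≟F x) ×-dec ¬? (p ≟F y) ×-dec ¬? (q ≟F x) ×-dec ¬? (q ≟F y) ×-dec ¬? (x ≟F y))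

    restrict : ∀ {R R′ : Fin N → Set} {c} → (∀ {v} → R v → R′ v) → Uniform R′ c → Uniform R c
    restrict R⊆R′ U = record { ρ = ρ ; α = α ; mono = λ u v u∈ v∈ → mono u v (R⊆R′ u∈) (R⊆R′ v∈) ; const = λ r r∈ → const r (R⊆R′ r∈) }
      where open Uniform U

    Endgame : Set
    Endgame = ∀ {s₀ s₁ s₂} → s₀ ≢ s₁ → s₀ ≢ s₂ → s₁ ≢ s₂ → ∀ {ρ b₀ b₁ b₂} →
              (∀ {t} → Off s₀ s₁ s₂ t → χ s₀ t ≡ b₀) → (∀ {t} → Off s₀ s₁ s₂ t → χ s₁ t ≡ b₁) →
              (∀ {t} → Off s₀ s₁ s₂ t → χ s₂ t ≡ b₂) → Monochromatic χ (Off s₀ s₁ s₂) ρ → ⊥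

    module NoSpare (i j l : Fin 3) (i≢j : i ≢ j) (i≢l : i ≢ l) (j≢l : j ≢ l)
                   (jᵢ jᵢ′ : Fin (deg i)) (jᵢ′≢jᵢ : jᵢ′ ≢ jᵢ) (jⱼ : Fin (deg j)) (jₗ : Fin (deg l))
                   (residueᵢ≢1 : ⟦ deg i ⟧ ≢ 1#) (residueₗ≢1 : ⟦ deg l ⟧ ≢ 1#) (room : 6 < N) (endgame : Endgame) where

      Off₄ : Fin N → Fin N → Fin N → Fin N → Fin N → Set
      Off₄ p q x y v = Fresh v (p ∷ x ∷ q ∷ y ∷ [])

      -- Centres of stars i and j at p and q with leaves at x and y: exchanging the leaves adds defect p q x y.
      uniform-of-defect : ∀ {p q x y} → Distinct₄ p q x y → defect p q x y ≢ 0# → Uniform (Off₄ p q x y) p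
      uniform-of-defect {p} {q} {x} {y} d defect≢0 =
        Uniformity.uniform B apart rigid i l i≢l p (λ φ agrees → at₀ agrees) jᵢ′ jₗ
          ((λ ()) ∷ (jᵢ′≢jᵢ ∘ sym ∘ leaf-index-injective) ∷ (λ ()) ∷ (i≢j ∘ sym ∘ leaf-star-injective) ∷ [])
          ((i≢l ∘ centre-injective) ∷ (λ ()) ∷ (j≢l ∘ centre-injective) ∷ (λ ()) ∷ [])
          (λ _ → (λ ()) ∷ (i≢l ∘ leaf-star-injective) ∷ (λ ()) ∷ (j≢l ∘ leaf-star-injective) ∷ [])
          residueₗ≢1 room
        where
        open Distinct₄ d
        B : List Placement
        B = (centre i , p) ∷ (leaf i jᵢ , x) ∷ (centre j , q) ∷ (leaf j jⱼ , y) ∷ []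
        apart : AllPairs Apart B
        apart = (((λ ()) , p≢x) ∷ ((i≢j ∘ centre-injective) , p≢q) ∷ ((λ ()) , p≢y) ∷ [])
              ∷ (((λ ()) , q≢x ∘ sym) ∷ ((i≢j ∘ leaf-star-injective) , x≢y) ∷ []) ∷ (((λ ()) , q≢y) ∷ []) ∷ [] ∷ []
        rigid : Rigid B (defect p q x y)
        rigid = rigid-by B defect≢0 λ φ φ-inj agrees →
                  copySum-leaf↔leaf φ φ-inj i jᵢ j jⱼ i≢j (at₀ agrees) (at₁ agrees) (at₂ agrees) (at₃ agrees)

      uniform-at-q : ∀ {p q x y} → Distinct₄ p q x y → defect p q x y ≢ 0# → Uniform (Off₄ p q x y) q
      uniform-at-q {p} {q} {x} {y} d defect≢0 =
        restrict (λ v∉ → at₂ v∉ ∷ at₃ v∉ ∷ at₀ v∉ ∷ at₁ v∉ ∷ [])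
          (uniform-of-defect (swap-stars d) (defect≢0 ∘ trans (sym (defect-swap-stars p q x y))))

      uniform-at-x : ∀ {p q x y} → Distinct₄ p q x y → defect p q x y ≢ 0# → Uniform (Off₄ p q x y) x
      uniform-at-x {p} {q} {x} {y} d defect≢0 =
        restrict (λ v∉ → at₁ v∉ ∷ at₀ v∉ ∷ at₃ v∉ ∷ at₂ v∉ ∷ [])
          (uniform-of-defect (swap-roles d) (defect≢0 ∘ trans (sym (defect-swap-roles p q x y))))

      uniform-at-y : ∀ {p q x y} → Distinct₄ p q x y → defect p q x y ≢ 0# → Uniform (Off₄ p q x y) y
      uniform-at-y {p} {q} {x} {y} d defect≢0 =
        restrict (λ v∉ → at₃ v∉ ∷ at₂ v∉ ∷ at₁ v∉ ∷ at₀ v∉ ∷ [])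
          (uniform-of-defect (swap-roles (swap-stars d))
            (defect≢0 ∘ trans (sym (trans (defect-swap-roles q p y x) (defect-swap-stars p q x y)))))

      -- Two defects with leaf positions y and r: the two uniform regions cover every vertex off {p, q, x}.
      module TwoDefects {p q x y r} (d : Distinct₄ p q x y) (r∉ : Off₄ p q x y r)
                        (defect≢0 : defect p q x y ≢ 0#) (defect′≢0 : defect p q x r ≢ 0#) where

        open Distinct₄ d
        d′ : Distinct₄ p q x r
        d′ = record { p≢q = p≢q ; p≢x = p≢x ; p≢y = at₀ r∉ ∘ sym ; q≢x = q≢x ; q≢y = at₂ r∉ ∘ sym ; x≢y = at₁ r∉ ∘ sym }
        open Uniform (uniform-of-defect d defect≢0) using (ρ; mono)
        open Uniform (uniform-of-defect d′ defect′≢0) using () renaming (ρ to ρ′; mono to mono′)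
        r₂-fresh = proj₂ (fresh (r ∷ p ∷ x ∷ q ∷ y ∷ []) (<-weaken room))
        r₂ = proj₁ (fresh (r ∷ p ∷ x ∷ q ∷ y ∷ []) (<-weaken room))
        r₃-fresh = proj₂ (fresh (r₂ ∷ r ∷ p ∷ x ∷ q ∷ y ∷ []) room)
        r₃ = proj₁ (fresh (r₂ ∷ r ∷ p ∷ x ∷ q ∷ y ∷ []) room)
        r₂∈ : Off₄ p q x y r₂
        r₂∈ = All.tail r₂-fresh
        r₂∈′ : Off₄ p q x r r₂
        r₂∈′ = at₁ r₂-fresh ∷ at₂ r₂-fresh ∷ at₃ r₂-fresh ∷ at₀ r₂-fresh ∷ []
        r₃∈ : Off₄ p q x y r₃
        r₃∈ = All.tail (All.tail r₃-fresh)
        r₃∈′ : Off₄ p q x r r₃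
        r₃∈′ = at₂ r₃-fresh ∷ at₃ r₃-fresh ∷ at₄ r₃-fresh ∷ at₁ r₃-fresh ∷ []
        y∈′ : Off₄ p q x r y
        y∈′ = (p≢y ∘ sym) ∷ (x≢y ∘ sym) ∷ (q≢y ∘ sym) ∷ (at₃ r∉ ∘ sym) ∷ []
        ρ′≡ρ : ρ′ ≡ ρ
        ρ′≡ρ = trans (sym (mono′ r₂ r₃ r₂∈′ r₃∈′ (at₀ r₃-fresh ∘ sym))) (mono r₂ r₃ r₂∈ r₃∈ (at₀ r₃-fresh ∘ sym))
        cover : ∀ {t} → Off p q x t → t ≢ y → Off₄ p q x y t
        cover t∉ t≢y = at₀ t∉ ∷ at₂ t∉ ∷ at₁ t∉ ∷ t≢y ∷ []
        cover′ : ∀ {t} → Off p q x t → t ≢ r → Off₄ p q x r t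
        cover′ t∉ t≢r = at₀ t∉ ∷ at₂ t∉ ∷ at₁ t∉ ∷ t≢r ∷ []
        constant : ∀ {c} (U : Uniform (Off₄ p q x y) c) → Uniform (Off₄ p q x r) c → ∀ {t} → Off p q x t → χ c t ≡ Uniform.α U
        constant U U′ {t} t∉ with t ≟F y
        ... | no t≢y = Uniform.const U t (cover t∉ t≢y)
        ... | yes refl = trans (Uniform.const U′ t y∈′) (trans (sym (Uniform.const U′ r₂ r₂∈′)) (Uniform.const U r₂ r₂∈))
        y-edge : ∀ {t} → Off p q x t → t ≢ y → χ y t ≡ ρ
        y-edge {t} t∉ t≢y with t ≟F r
        ... | no t≢r = trans (mono′ y t y∈′ (cover′ t∉ t≢r) (t≢y ∘ sym)) ρ′≡ρ
        ... | yes refl = trans (Uniform.const U-y t r∉) (trans (sym (Uniform.const U-y r₂ r₂∈))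
                           (trans (mono′ y r₂ y∈′ r₂∈′ (at₄ r₂-fresh ∘ sym)) ρ′≡ρ))
          where
          U-y = uniform-at-y d defect≢0
        mono₃ : Monochromatic χ (Off p q x) ρ
        mono₃ t t′ t∉ t′∉ t≢t′ with t ≟F y | t′ ≟F y
        ... | yes refl | yes refl = ⊥-elim (t≢t′ refl)
        ... | yes refl | no t′≢y = y-edge t′∉ t′≢y
        ... | no t≢y | yes refl = trans (χ-sym t t′) (y-edge t∉ t≢y)
        ... | no t≢y | no t′≢y = mono t t′ (cover t∉ t≢y) (cover t′∉ t′≢y) t≢t′

        impossible : ⊥
        impossible = endgame p≢q p≢x q≢x (constant (uniform-of-defect d defect≢0) (uniform-of-defect d′ defect′≢0))
                                         (constant (uniform-at-q d defect≢0) (uniform-at-q d′ defect′≢0))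
                                         (constant (uniform-at-x d defect≢0) (uniform-at-x d′ defect′≢0)) mono₃

      -- A second leaf position r with defect p q x r = 0 gives defect q p y r ≢ 0 by the cocycle identity.
      defect⇒⊥ : ∀ {p q x y} → Distinct₄ p q x y → defect p q x y ≢ 0# → ⊥
      defect⇒⊥ {p} {q} {x} {y} d defect≢0 with fresh (p ∷ x ∷ q ∷ y ∷ []) (<-weaken (<-weaken room))
      ... | r , r∉ with defect p q x r ≟F 0#
      ...   | no defect′≢0 = TwoDefects.impossible d r∉ defect≢0 defect′≢0
      ...   | yes defect′≡0 =
                TwoDefects.impossible (swap-stars d) (at₂ r∉ ∷ at₃ r∉ ∷ at₀ r∉ ∷ at₁ r∉ ∷ [])
                  (defect≢0 ∘ trans (sym (defect-swap-stars p q x y)))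
                  λ e → defect≢0 (trans (defect-cocycle p q x y r) (cong₂ _⊕_ defect′≡0 (trans (sym (defect-swap-stars p q r y)) e)))

      module NoDefect (no-defect : ∀ {p q x y} → Distinct₄ p q x y → defect p q x y ≡ 0#) where

        difference-independent : ∀ {u v m m′} → u ≢ v → u ≢ m → u ≢ m′ → v ≢ m → v ≢ m′ → χ v m′ ⊝ χ u m′ ≡ χ v m ⊝ χ u m
        difference-independent {u} {v} {m} {m′} u≢v u≢m u≢m′ v≢m v≢m′ with m′ ≟F m
        ... | yes refl = refl
        ... | no m′≢m = rearrange (χ v m′) (χ v m) (χ u m) (χ u m′)
                          (no-defect (record { p≢q = u≢v ∘ sym ; p≢x = v≢m ; p≢y = v≢m′ ; q≢x = u≢m ; q≢y = u≢m′ ; x≢y = m′≢m ∘ sym }))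
          where
          rearrange : ∀ a b c d → (a ⊝ b) ⊕ (c ⊝ d) ≡ 0# → a ⊝ d ≡ b ⊝ c
          rearrange = exhaustive₄ λ a b c d → ((a ⊝ b) ⊕ (c ⊝ d) ≟F 0#) →-dec (a ⊝ d ≟F b ⊝ c)

        -- Exchanging centre and leaf of star i (at u and v) changes the sum by (deg i − 1) κ ≢ 0, so the
        -- same exchange in star l, changing it by (deg l − 1) κ′, forces κ′ = 0.
        same-colours : ∀ {u v m} → u ≢ v → u ≢ m → v ≢ m → χ v m ≢ χ u m →
                       ∀ {u′ v′} → u′ ≢ v′ → Fresh u′ (u ∷ v ∷ []) → Fresh v′ (u ∷ v ∷ []) →
                       ∀ {m′} → m′ ≢ u′ → m′ ≢ v′ → χ v′ m′ ≡ χ u′ m′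
        same-colours {u} {v} {m} u≢v u≢m v≢m χvm≢χum {u′} {v′} u′≢v′ u′∉ v′∉ {m′} m′≢u′ m′≢v′ =
          ⊝≡0⇒≡ _ _ (trans (difference-independent u′≢v′ (at₀ u′∉) (m′≢u′ ∘ sym) (at₀ v′∉) (m′≢v′ ∘ sym)) κ′≡0)
          where
          κ = χ v m ⊝ χ u m
          B : List Placement
          B = (centre i , u) ∷ (leaf i jᵢ , v) ∷ []
          κ-difference : ∀ φ → Inj φ → Agree φ B → ∀ j → j ≢ jᵢ → χ v (φ (leaf i j)) ⊝ χ u (φ (leaf i j)) ≡ κ
          κ-difference φ φ-inj agrees j j≢jᵢ = difference-independent u≢v u≢m (at₀ w∉ ∘ sym) v≢m (at₁ w∉ ∘ sym)
            where
            w∉ = unplaced-fresh φ φ-inj B agrees (leaf i j) ((λ ()) ∷ (j≢jᵢ ∘ sym ∘ leaf-index-injective) ∷ [])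
          rigid : Rigid B (⟦ deg i ⟧ ⊗ κ ⊕ (0# ⊝ κ))
          rigid = rigid-by B (λ e → χvm≢χum (⊝≡0⇒≡ _ _ (scaled-pred≡0⇒≡0 ⟦ deg i ⟧ κ residueᵢ≢1 e)))
                    λ φ φ-inj agrees → copySum-centre↔leaf φ φ-inj i jᵢ κ (at₀ agrees) (at₁ agrees) (κ-difference φ φ-inj agrees)
          E : List Placement
          E = (centre l , u′) ∷ (leaf l jₗ , v′) ∷ []
          open Extension (extend E ((((λ ()) , u′≢v′) ∷ []) ∷ [] ∷ []) ((((λ ()) , u≢v) ∷ []) ∷ [] ∷ [])
                            ((((i≢l ∘ sym ∘ centre-injective) , at₀ u′∉) ∷ ((λ ()) , at₁ u′∉) ∷ [])
                             ∷ (((λ ()) , at₀ v′∉) ∷ ((i≢l ∘ sym ∘ leaf-star-injective) , at₁ v′∉) ∷ []) ∷ []))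
          κ′ = χ v′ u ⊝ χ u′ u
          κ′-difference : ∀ j → j ≢ jₗ → χ v′ (φ (leaf l j)) ⊝ χ u′ (φ (leaf l j)) ≡ κ′
          κ′-difference j j≢jₗ =
            difference-independent u′≢v′ (at₀ u′∉) (λ e → centre≢leaf (φ-inj (trans (at₀ agrees-E) e))) (at₀ v′∉)
              (λ e → j≢jₗ (sym (leaf-index-injective (φ-inj (trans (at₁ agrees-E) e)))))
          κ′≡0 : κ′ ≡ 0#
          κ′≡0 = scaled-pred≡0⇒≡0 ⟦ deg l ⟧ κ′ residueₗ≢1
                   (rigid-exchange rigid φ φ-inj agrees-B (((i≢l ∘ centre-injective) , (λ ())) ∷ ((λ ()) , (i≢l ∘ leaf-star-injective)) ∷ [])
                     (copySum-centre↔leaf φ φ-inj l jₗ κ′ (at₀ agrees-E) (at₁ agrees-E) κ′-difference))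

        impossible : ⊥
        impossible = let m , a , b , m≢a , m≢b , a≢b , χma≢χmb = cherry in from-cherry m≢a m≢b a≢b χma≢χmb
          where
          from-cherry : ∀ {m a b} → m ≢ a → m ≢ b → a ≢ b → χ m a ≢ χ m b → ⊥
          from-cherry {m} {a} {b} m≢a m≢b a≢b χma≢χmb =
            endgame a≢b (at₀ y₀∉ ∘ sym) (at₁ y₀∉ ∘ sym)
              (const a (at₀ y₁∉ ∘ sym) (λ t∉ → at₀ t∉ ∘ sym)) (const b (at₁ y₁∉ ∘ sym) (λ t∉ → at₁ t∉ ∘ sym))
              (λ t∉ → mono y₀ _ y₀∉ (at₀ t∉ ∷ at₁ t∉ ∷ []) (at₂ t∉ ∘ sym))
              (λ t t′ t∉ t′∉ → mono t t′ (at₀ t∉ ∷ at₁ t∉ ∷ []) (at₀ t′∉ ∷ at₁ t′∉ ∷ []))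
            where
            twins : ∀ {u′ v′} → u′ ≢ v′ → Fresh u′ (a ∷ b ∷ []) → Fresh v′ (a ∷ b ∷ []) → ∀ {m′} → m′ ≢ u′ → m′ ≢ v′ → χ v′ m′ ≡ χ u′ m′
            twins = same-colours a≢b (m≢a ∘ sym) (m≢b ∘ sym) λ e → χma≢χmb (trans (χ-sym m a) (trans (sym e) (χ-sym b m)))
            y₀ = proj₁ (fresh (a ∷ b ∷ []) (<-weaken (<-weaken (<-weaken (<-weaken room)))))
            y₀∉ : Fresh y₀ (a ∷ b ∷ [])
            y₀∉ = proj₂ (fresh (a ∷ b ∷ []) (<-weaken (<-weaken (<-weaken (<-weaken room)))))
            y₁-fresh = proj₂ (fresh (y₀ ∷ a ∷ b ∷ []) (<-weaken (<-weaken (<-weaken room))))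
            y₁ = proj₁ (fresh (y₀ ∷ a ∷ b ∷ []) (<-weaken (<-weaken (<-weaken room))))
            y₁∉ : Fresh y₁ (a ∷ b ∷ [])
            y₁∉ = All.tail y₁-fresh
            mono : Monochromatic χ (λ v → Fresh v (a ∷ b ∷ [])) (χ y₀ y₁)
            mono = locallyConstant⇒monochromatic χ-sym
                     (λ w w₁ w₂ w∉ w₁∉ w₂∉ w≢w₁ w≢w₂ w₁≢w₂ → trans (χ-sym w w₁) (trans (sym (twins w₁≢w₂ w₁∉ w₂∉ w≢w₁ w≢w₂)) (χ-sym w₂ w)))
                     y₀∉ y₁∉ (at₀ y₁-fresh ∘ sym)
            const : ∀ c → c ≢ y₁ → (∀ {t} → Off a b y₀ t → c ≢ t) → ∀ {t} → Off a b y₀ t → χ c t ≡ χ c y₁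
            const c c≢y₁ c≢ {t} t∉ with t ≟F y₁
            ... | yes refl = refl
            ... | no t≢y₁ = trans (χ-sym c t) (trans (twins (t≢y₁ ∘ sym) y₁∉ (at₀ t∉ ∷ at₁ t∉ ∷ []) c≢y₁ (c≢ t∉)) (χ-sym y₁ c))

      impossible : ⊥
      impossible with any? (λ p → any? λ q → any? λ x → any? λ y → distinct₄? p q x y ×-dec ¬? (defect p q x y ≟F 0#))
      ... | yes (p , q , x , y , d , defect≢0) = defect⇒⊥ d defect≢0
      ... | no none = NoDefect.impossible no-defect
        where
        no-defect : ∀ {p q x y} → Distinct₄ p q x y → defect p q x y ≡ 0#
        no-defect {p} {q} {x} {y} d with defect p q x y ≟F 0#
        ... | yes defect≡0 = defect≡0
        ... | no defect≢0 = ⊥-elim (none (p , q , x , y , d , defect≢0))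

    zero-residues-endgame : (∀ s → ⟦ deg s ⟧ ≡ 0#) → Endgame
    zero-residues-endgame residue {s₀} {s₁} {s₂} s₀≢s₁ s₀≢s₂ s₁≢s₂ {ρ} {b₀} {b₁} {b₂} c₀ c₁ c₂ _ =
      copySum≢0 φ φ-inj (∑-zeros (starSum φ) λ s → trans (starSum-constant φ s (colour s) (edges s)) (cong (_⊗ colour s) (residue s)))
      where
      L : List Placement
      L = (centre 0# , s₀) ∷ (centre 1# , s₁) ∷ (centre 2# , s₂) ∷ []
      φ = realise L
      φ-inj = realise-injective L
      agrees = realise-agrees L ((((λ ()) , s₀≢s₁) ∷ ((λ ()) , s₀≢s₂) ∷ []) ∷ (((λ ()) , s₁≢s₂) ∷ []) ∷ [] ∷ [])
      leaf∉ : ∀ s j → Off s₀ s₁ s₂ (φ (leaf s j))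
      leaf∉ s j = unplaced-fresh φ φ-inj L agrees (leaf s j) ((λ ()) ∷ (λ ()) ∷ (λ ()) ∷ [])
      colour : Fin 3 → ℤ₃
      colour 0# = b₀
      colour 1# = b₁
      colour 2# = b₂
      edges : ∀ s j → χ (φ (centre s)) (φ (leaf s j)) ≡ colour s
      edges 0# j rewrite at₀ agrees = c₀ (leaf∉ 0# j)
      edges 1# j rewrite at₁ agrees = c₁ (leaf∉ 1# j)
      edges 2# j rewrite at₂ agrees = c₂ (leaf∉ 2# j)

    module DistinctResidues (A B C : Fin 3) (A≢B : A ≢ B) (A≢C : A ≢ C) (B≢C : B ≢ C)
                            (residueA : ⟦ deg A ⟧ ≡ 0#) (residueB : ⟦ deg B ⟧ ≡ 1#) (residueC : ⟦ deg C ⟧ ≡ 2#)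
                            (jA : Fin (deg A)) (jC : Fin (deg C)) where

      -- Centres of equal colour β on the stars of residue 1 and 2 contribute β + 2β = 0.
      equal-constants⇒⊥ : ∀ {T : Fin N → Set} {x y z} → x ≢ y → x ≢ z → y ≢ z → (∀ {m} → Off x y z m → T m) →
                          ∀ {β γ} → (∀ {t} → T t → χ x t ≡ β) → (∀ {t} → T t → χ y t ≡ β) → (∀ {t} → T t → χ z t ≡ γ) → ⊥
      equal-constants⇒⊥ {T} {x} {y} {z} x≢y x≢z y≢z into {β} {γ} cx cy cz =
        copySum≢0 φ φ-inj
          (trans (∑-Fin3 (starSum φ) B≢C (A≢B ∘ sym) (A≢C ∘ sym))
            (trans (cong₂ _⊕_ (cong₂ _⊕_ (star B (at₀ agrees) cx residueB) (star C (at₁ agrees) cy residueC)) (star A (at₂ agrees) cz residueA))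
                   (vanishes β γ)))
        where
        L : List Placement
        L = (centre B , x) ∷ (centre C , y) ∷ (centre A , z) ∷ []
        φ = realise L
        φ-inj = realise-injective L
        agrees = realise-agrees L ((((B≢C ∘ centre-injective) , x≢y) ∷ ((A≢B ∘ sym ∘ centre-injective) , x≢z) ∷ [])
                                   ∷ (((A≢C ∘ sym ∘ centre-injective) , y≢z) ∷ []) ∷ [] ∷ [])
        star : ∀ s {v b r} → φ (centre s) ≡ v → (∀ {t} → T t → χ v t ≡ b) → ⟦ deg s ⟧ ≡ r → starSum φ s ≡ r ⊗ b
        star s {b = b} φs≡v constant residue =
          trans (starSum-constant φ s b λ j → trans (cong (λ w → χ w (φ (leaf s j))) φs≡v)
                                                 (constant (into (unplaced-fresh φ φ-inj L agrees (leaf s j) ((λ ()) ∷ (λ ()) ∷ (λ ()) ∷ [])))))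
                (cong (_⊗ b) residue)
        vanishes : ∀ β γ → 1# ⊗ β ⊕ 2# ⊗ β ⊕ 0# ⊗ γ ≡ 0#
        vanishes = exhaustive₂ λ β γ → 1# ⊗ β ⊕ 2# ⊗ β ⊕ 0# ⊗ γ ≟F 0#

      -- Centre of residue 1 at s₀ and the other two stars hanging a leaf at s₁ and s₂: relative to ρ the sum is
      -- (b₀ − ρ) + (b₁ − ρ) + (b₂ − ρ) = b₀ + b₁ + b₂.
      distinct-constants⇒⊥ : ∀ {s₀ s₁ s₂} → s₀ ≢ s₁ → s₀ ≢ s₂ → s₁ ≢ s₂ → ∀ {ρ b₀ b₁ b₂} →
                             (∀ {t} → Off s₀ s₁ s₂ t → χ s₀ t ≡ b₀) → (∀ {t} → Off s₀ s₁ s₂ t → χ s₁ t ≡ b₁) →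
                             (∀ {t} → Off s₀ s₁ s₂ t → χ s₂ t ≡ b₂) → Monochromatic χ (Off s₀ s₁ s₂) ρ → b₀ ⊕ b₁ ⊕ b₂ ≡ 0# → ⊥
      distinct-constants⇒⊥ {s₀} {s₁} {s₂} s₀≢s₁ s₀≢s₂ s₁≢s₂ {ρ} {b₀} {b₁} {b₂} c₀ c₁ c₂ mono sum≡0 =
        copySum≢0 φ φ-inj
          (trans (copySum-relative φ ρ)
            (trans (∑-Fin3 (λ s → starSum φ s ⊝ ⟦ deg s ⟧ ⊗ ρ) (A≢B ∘ sym) B≢C A≢C)
              (trans (cong₂ _⊕_ (cong₂ _⊕_ relative-B (hanging A jA (at₁ agrees) c₁ A-free A-leaf-free))
                                (hanging C jC (at₂ agrees) c₂ C-free C-leaf-free))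
                     (shifted b₀ b₁ b₂ ρ sum≡0))))
        where
        L : List Placement
        L = (centre B , s₀) ∷ (leaf A jA , s₁) ∷ (leaf C jC , s₂) ∷ []
        φ = realise L
        φ-inj = realise-injective L
        agrees = realise-agrees L ((((λ ()) , s₀≢s₁) ∷ ((λ ()) , s₀≢s₂) ∷ []) ∷ (((A≢C ∘ leaf-star-injective) , s₁≢s₂) ∷ []) ∷ [] ∷ [])
        off : ∀ x → All (λ q → proj₁ q ≢ x) L → Off s₀ s₁ s₂ (φ x)
        off = unplaced-fresh φ φ-inj L agrees
        relative-B : starSum φ B ⊝ ⟦ deg B ⟧ ⊗ ρ ≡ b₀ ⊝ ρ
        relative-B = trans (cong (_⊝ ⟦ deg B ⟧ ⊗ ρ)
                             (starSum-constant φ B b₀ λ j → trans (cong (λ w → χ w (φ (leaf B j))) (at₀ agrees))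
                                                                   (c₀ (off (leaf B j) ((λ ()) ∷ (A≢B ∘ leaf-star-injective) ∷ (B≢C ∘ sym ∘ leaf-star-injective) ∷ [])))))
                           (cong (λ r → r ⊗ b₀ ⊝ r ⊗ ρ) residueB)
        A-free = (A≢B ∘ sym ∘ centre-injective) ∷ (λ ()) ∷ (λ ()) ∷ []
        C-free = (B≢C ∘ centre-injective) ∷ (λ ()) ∷ (λ ()) ∷ []
        A-leaf-free : ∀ j → j ≢ jA → All (λ q → proj₁ q ≢ leaf A j) L
        A-leaf-free j j≢ = (λ ()) ∷ (j≢ ∘ sym ∘ leaf-index-injective) ∷ (A≢C ∘ sym ∘ leaf-star-injective) ∷ []
        C-leaf-free : ∀ j → j ≢ jC → All (λ q → proj₁ q ≢ leaf C j) L
        C-leaf-free j j≢ = (λ ()) ∷ (A≢C ∘ leaf-star-injective) ∷ (j≢ ∘ sym ∘ leaf-index-injective) ∷ []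
        hanging : ∀ s j₀ {v b} → φ (leaf s j₀) ≡ v → (∀ {t} → Off s₀ s₁ s₂ t → χ v t ≡ b) → All (λ q → proj₁ q ≢ centre s) L →
                  (∀ j → j ≢ j₀ → All (λ q → proj₁ q ≢ leaf s j) L) → starSum φ s ⊝ ⟦ deg s ⟧ ⊗ ρ ≡ b ⊝ ρ
        hanging s j₀ {v} φj₀≡v constant centre-free leaf-free =
          trans (starSum-relative-except φ s ρ j₀ λ j j≢ → mono _ _ (off (centre s) centre-free) (off (leaf s j) (leaf-free j j≢)) (centre≢leaf ∘ φ-inj))
                (cong (_⊝ ρ) (trans (cong (χ (φ (centre s))) φj₀≡v) (trans (χ-sym _ v) (constant (off (centre s) centre-free)))))
        shifted : ∀ a b c ρ → a ⊕ b ⊕ c ≡ 0# → (a ⊝ ρ) ⊕ (b ⊝ ρ) ⊕ (c ⊝ ρ) ≡ 0#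
        shifted = exhaustive₄ λ a b c ρ → (a ⊕ b ⊕ c ≟F 0#) →-dec ((a ⊝ ρ) ⊕ (b ⊝ ρ) ⊕ (c ⊝ ρ) ≟F 0#)

      endgame : Endgame
      endgame {s₀} {s₁} {s₂} s₀≢s₁ s₀≢s₂ s₁≢s₂ {ρ} {b₀} {b₁} {b₂} c₀ c₁ c₂ mono with b₀ ≟F b₁ | b₀ ≟F b₂ | b₁ ≟F b₂
      ... | yes refl | _ | _ = equal-constants⇒⊥ s₀≢s₁ s₀≢s₂ s₁≢s₂ id c₀ c₁ c₂
      ... | no _ | yes refl | _ = equal-constants⇒⊥ s₀≢s₂ s₀≢s₁ (s₁≢s₂ ∘ sym) (λ m∉ → at₀ m∉ ∷ at₂ m∉ ∷ at₁ m∉ ∷ []) c₀ c₂ c₁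
      ... | no _ | no _ | yes refl = equal-constants⇒⊥ s₁≢s₂ (s₀≢s₁ ∘ sym) (s₀≢s₂ ∘ sym) (λ m∉ → at₂ m∉ ∷ at₀ m∉ ∷ at₁ m∉ ∷ []) c₁ c₂ c₀
      ... | no b₀≢b₁ | no b₀≢b₂ | no b₁≢b₂ = distinct-constants⇒⊥ s₀≢s₁ s₀≢s₂ s₁≢s₂ c₀ c₁ c₂ mono (all-three b₀ b₁ b₂ b₀≢b₁ b₀≢b₂ b₁≢b₂)
        where
        all-three : ∀ a b c → a ≢ b → a ≢ c → b ≢ c → a ⊕ b ⊕ c ≡ 0#
        all-three = exhaustive₃ λ a b c → ¬? (a ≟F b) →-dec (¬? (a ≟F c) →-dec (¬? (b ≟F c) →-dec (a ⊕ b ⊕ c ≟F 0#)))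

module Theorem (d₁ d₂ d₃ : ℕ) (1≤d₁ : 1 ≤ d₁) (1≤d₂ : 1 ≤ d₂) (1≤d₃ : 1 ≤ d₃) (3∣n : 3 ∣ d₁ + d₂ + d₃) where

  open Forest d₁ d₂ d₃ using (deg; order; zeroSumCopy?)
  open LowerBounds d₁ d₂ d₃ using (too-few-vertices; module ResiduesOne; module ResiduesTwo)

  private
    G : Graph
    G = S d₁ d₂ d₃

    n : ℕ
    n = d₁ + d₂ + d₃

  n≡0 : ⟦ n ⟧ ≡ 0#
  n≡0 = ⟦⟧-from%3 n 0# (n∣m⇒m%n≡0 n 3 3∣n)

  order+ : ∀ k → order + k ≡ n + (3 + k)
  order+ k = trans (cong (_+ k) (order≡ d₁ d₂ d₃)) (+-assoc n 3 k)
    where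
    order≡ : ∀ a b c → suc a + (suc b + suc c) ≡ a + b + c + 3
    order≡ = solve-∀

  1≤deg : ∀ s → 1 ≤ deg s
  1≤deg 0# = 1≤d₁
  1≤deg 1# = 1≤d₂
  1≤deg 2# = 1≤d₃

  firstLeaf : ∀ s → Fin (deg s)
  firstLeaf s = fromℕ< (1≤deg s)

  secondLeaf : ∀ s → 2 ≤ deg s → Σ (Fin (deg s)) (_≢ firstLeaf s)
  secondLeaf s 2≤deg = fromℕ< 2≤deg , λ e → case trans (sym (toℕ-fromℕ< 2≤deg)) (trans (cong toℕ e) (toℕ-fromℕ< (1≤deg s))) of λ ()

  residue≢1⇒2≤ : ∀ {d} → 1 ≤ d → ⟦ d ⟧ ≢ 1# → 2 ≤ d
  residue≢1⇒2≤ {suc zero} _ r≢1 = ⊥-elim (r≢1 refl)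
  residue≢1⇒2≤ {suc (suc d)} _ _ = s≤s (s≤s z≤n)

  residue≡0⇒3≤ : ∀ {d} → 1 ≤ d → ⟦ d ⟧ ≡ 0# → 3 ≤ d
  residue≡0⇒3≤ {suc (suc (suc d))} _ _ = s≤s (s≤s (s≤s z≤n))

  residues : ∀ r → d₁ % 3 ≡ toℕ r → d₂ % 3 ≡ toℕ r → d₃ % 3 ≡ toℕ r → ∀ s → ⟦ deg s ⟧ ≡ r
  residues r e₁ e₂ e₃ 0# = ⟦⟧-from%3 d₁ r e₁
  residues r e₁ e₂ e₃ 1# = ⟦⟧-from%3 d₂ r e₂
  residues r e₁ e₂ e₃ 2# = ⟦⟧-from%3 d₃ r e₃

  sum≤n : ∀ {a b c} → a ≤ d₁ → b ≤ d₂ → c ≤ d₃ → a + b + c ≤ n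
  sum≤n a≤ b≤ c≤ = +-mono-≤ (+-mono-≤ a≤ b≤) c≤

  residues-sum≡0 : ∑ (λ s → ⟦ deg s ⟧) ≡ 0#
  residues-sum≡0 =
    trans (regroup ⟦ d₁ ⟧ ⟦ d₂ ⟧ ⟦ d₃ ⟧) (trans (sym (trans (⟦⟧-+ (d₁ + d₂) d₃) (cong (_⊕ ⟦ d₃ ⟧) (⟦⟧-+ d₁ d₂)))) n≡0)
    where
    regroup : ∀ a b c → a ⊕ (b ⊕ (c ⊕ 0#)) ≡ a ⊕ b ⊕ c
    regroup = exhaustive₃ λ a b c → a ⊕ (b ⊕ (c ⊕ 0#)) ≟F a ⊕ b ⊕ c

  module Counterexample {k} (χ : Coloring (order + k)) (χ-sym : Symmetric χ) (¬copy : ¬ ZeroSumCopy G χ) =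
    Embeddings.NoZeroSum d₁ d₂ d₃ k (order + k) refl χ χ-sym residues-sum≡0 ¬copy

  arrows : ∀ k → (∀ (χ : Coloring (order + k)) → Symmetric χ → ¬ ZeroSumCopy G χ → ⊥) → Arrows G (n + (3 + k))
  arrows k no-counterexample = subst (Arrows G) (order+ k) by-contradiction
    where
    by-contradiction : Arrows G (order + k)
    by-contradiction χ χ-sym with zeroSumCopy? χ
    ... | yes copy = copy
    ... | no ¬copy = ⊥-elim (no-counterexample χ χ-sym ¬copy)

  room : ∀ {m} k → m ≤ n → m + (3 + k) ≤ order + k
  room {m} k m≤n = subst (m + (3 + k) ≤_) (sym (order+ k)) (+-monoˡ-≤ (3 + k) m≤n)

  residues-one : (d₁ % 3 ≡ 1 × d₂ % 3 ≡ 1 × d₃ % 3 ≡ 1) → ZSRamseyIs G (n + 5)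
  residues-one (e₁ , e₂ , e₃) =
    arrows 2 (λ χ χ-sym ¬copy → Counterexample.TwoSpares.impossible {2} χ χ-sym ¬copy zero (suc zero) (λ ()) firstLeaf
                                  (room 2 (sum≤n 1≤d₁ z≤n z≤n))) ,
    λ M M<N → ResiduesOne.no-arrows (residues 1# e₁ e₂ e₃) M (subst (M <_) (sym (order+ 2)) M<N)

  residues-two : (d₁ % 3 ≡ 2 × d₂ % 3 ≡ 2 × d₃ % 3 ≡ 2) → ZSRamseyIs G (n + 4)
  residues-two (e₁ , e₂ , e₃) =
    arrows 1 (λ χ χ-sym ¬copy → Counterexample.OneSpare.impossible {1} χ χ-sym ¬copy zero firstLeaf
                                  (proj₁ (secondLeaf 0# (2≤deg 0#))) (proj₂ (secondLeaf 0# (2≤deg 0#)))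
                                  (λ r≡1 → case trans (sym (residue₂ 1#)) r≡1 of λ ()) (room 1 (sum≤n (2≤deg 0#) (2≤deg 1#) z≤n))) ,
    λ M M<N → ResiduesTwo.no-arrows residue₂ M (subst (M <_) (sym (order+ 1)) M<N)
    where
    residue₂ = residues 2# e₁ e₂ e₃
    2≤deg : ∀ s → 2 ≤ deg s
    2≤deg s = residue≢1⇒2≤ (1≤deg s) λ r≡1 → case trans (sym (residue₂ s)) r≡1 of λ ()

  residues-zero : (d₁ % 3 ≡ 0 × d₂ % 3 ≡ 0 × d₃ % 3 ≡ 0) → Arrows G (n + 3)
  residues-zero (e₁ , e₂ , e₃) = arrows 0 λ χ χ-sym ¬copy →
    Counterexample.NoSpare.impossible {0} χ χ-sym ¬copy 0# 1# 2# (λ ()) (λ ()) (λ ())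
      (firstLeaf 0#) (proj₁ (secondLeaf 0# 2≤deg₀)) (proj₂ (secondLeaf 0# 2≤deg₀)) (firstLeaf 1#) (firstLeaf 2#)
      (≢1 0#) (≢1 2#) (room 0 (sum≤n (3≤deg 0#) 1≤d₂ z≤n))
      (Counterexample.zero-residues-endgame {0} χ χ-sym ¬copy residue₀)
    where
    residue₀ = residues 0# e₁ e₂ e₃
    ≢1 : ∀ s → ⟦ deg s ⟧ ≢ 1#
    ≢1 s r≡1 = case trans (sym (residue₀ s)) r≡1 of λ ()
    3≤deg : ∀ s → 3 ≤ deg s
    3≤deg s = residue≡0⇒3≤ (1≤deg s) (residue₀ s)
    2≤deg₀ : 2 ≤ deg 0#
    2≤deg₀ = residue≢1⇒2≤ (1≤deg 0#) (≢1 0#)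

  module ResidueStars (n₁₂ : d₁ % 3 ≢ d₂ % 3) (n₁₃ : d₁ % 3 ≢ d₃ % 3) (n₂₃ : d₂ % 3 ≢ d₃ % 3) where

    distinct : ∀ a b → a % 3 ≢ b % 3 → ⟦ a ⟧ ≢ ⟦ b ⟧
    distinct a b a≢b e = a≢b (trans (sym (toℕ-⟦⟧ a)) (trans (cong toℕ e) (toℕ-⟦⟧ b)))

    starWithResidue : ∀ r → Σ (Fin 3) λ s → ⟦ deg s ⟧ ≡ r
    starWithResidue r with any? (λ s → ⟦ deg s ⟧ ≟F r)
    ... | yes found = found
    ... | no none = ⊥-elim (three-values ⟦ d₁ ⟧ ⟦ d₂ ⟧ ⟦ d₃ ⟧ r (distinct d₁ d₂ n₁₂) (distinct d₁ d₃ n₁₃) (distinct d₂ d₃ n₂₃)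
                                (λ e → none (0# , e)) (λ e → none (1# , e)) (λ e → none (2# , e)))
      where
      three-values : ∀ a b c r → a ≢ b → a ≢ c → b ≢ c → a ≢ r → b ≢ r → c ≢ r → ⊥
      three-values = exhaustive₄ λ a b c r → ¬? (a ≟F b) →-dec (¬? (a ≟F c) →-dec (¬? (b ≟F c) →-dec
                       (¬? (a ≟F r) →-dec (¬? (b ≟F r) →-dec (¬? (c ≟F r) →-dec no λ ())))))

    A B C : Fin 3
    A = proj₁ (starWithResidue 0#)
    B = proj₁ (starWithResidue 1#)
    C = proj₁ (starWithResidue 2#)

    residueA : ⟦ deg A ⟧ ≡ 0#
    residueA = proj₂ (starWithResidue 0#)
    residueB : ⟦ deg B ⟧ ≡ 1#
    residueB = proj₂ (starWithResidue 1#)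
    residueC : ⟦ deg C ⟧ ≡ 2#
    residueC = proj₂ (starWithResidue 2#)

    A≢B : A ≢ B
    A≢B A≡B = case trans (sym residueA) (trans (cong (⟦_⟧ ∘ deg) A≡B) residueB) of λ ()
    A≢C : A ≢ C
    A≢C A≡C = case trans (sym residueA) (trans (cong (⟦_⟧ ∘ deg) A≡C) residueC) of λ ()
    B≢C : B ≢ C
    B≢C B≡C = case trans (sym residueB) (trans (cong (⟦_⟧ ∘ deg) B≡C) residueC) of λ ()

    2≤A : 2 ≤ deg A
    2≤A = residue≢1⇒2≤ (1≤deg A) λ r≡1 → case trans (sym residueA) r≡1 of λ ()

    -- At most one of d₁, d₂ has residue 1.
    4≤n : 4 ≤ n
    4≤n with ⟦ d₁ ⟧ ≟F 1#
    ... | no r₁≢1 = sum≤n (residue≢1⇒2≤ 1≤d₁ r₁≢1) 1≤d₂ 1≤d₃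
    ... | yes r₁≡1 = sum≤n 1≤d₁ (residue≢1⇒2≤ 1≤d₂ λ r₂≡1 → distinct d₁ d₂ n₁₂ (trans r₁≡1 (sym r₂≡1))) 1≤d₃

  residues-distinct : (d₁ % 3 ≢ d₂ % 3 × d₁ % 3 ≢ d₃ % 3 × d₂ % 3 ≢ d₃ % 3) → Arrows G (n + 3)
  residues-distinct (n₁₂ , n₁₃ , n₂₃) = arrows 0 λ χ χ-sym ¬copy →
    Counterexample.NoSpare.impossible {0} χ χ-sym ¬copy A B C A≢B A≢C B≢C
      (firstLeaf A) (proj₁ (secondLeaf A 2≤A)) (proj₂ (secondLeaf A 2≤A)) (firstLeaf B) (firstLeaf C)
      (λ r≡1 → case trans (sym residueA) r≡1 of λ ()) (λ r≡1 → case trans (sym residueC) r≡1 of λ ()) (room 0 4≤n)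
      (Counterexample.DistinctResidues.endgame {0} χ χ-sym ¬copy A B C A≢B A≢C B≢C residueA residueB residueC
        (firstLeaf A) (firstLeaf C))
    where
    open ResidueStars n₁₂ n₁₃ n₂₃

  residues-zero-or-distinct : ((d₁ % 3 ≡ 0 × d₂ % 3 ≡ 0 × d₃ % 3 ≡ 0) ⊎ (d₁ % 3 ≢ d₂ % 3 × d₁ % 3 ≢ d₃ % 3 × d₂ % 3 ≢ d₃ % 3)) →
                              ZSRamseyIs G (n + 3)
  residues-zero-or-distinct residues =
    Sum.[ residues-zero , residues-distinct ] residues , λ M M<N → too-few-vertices (subst (M <_) (sym (trans (sym (+-identityʳ order)) (order+ 0))) M<N)

proposition4p24 : (d₁ d₂ d₃ : ℕ) → 1 ≤ d₁ → 1 ≤ d₂ → 1 ≤ d₃ → 3 ∣ (d₁ + d₂ + d₃) →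
    ((d₁ % 3 ≡ 1 × d₂ % 3 ≡ 1 × d₃ % 3 ≡ 1) → ZSRamseyIs (S d₁ d₂ d₃) (d₁ + d₂ + d₃ + 5)) ×
    ((d₁ % 3 ≡ 2 × d₂ % 3 ≡ 2 × d₃ % 3 ≡ 2) → ZSRamseyIs (S d₁ d₂ d₃) (d₁ + d₂ + d₃ + 4)) ×
    (((d₁ % 3 ≡ 0 × d₂ % 3 ≡ 0 × d₃ % 3 ≡ 0)
      ⊎ (d₁ % 3 ≢ d₂ % 3 × d₁ % 3 ≢ d₃ % 3 × d₂ % 3 ≢ d₃ % 3))
      → ZSRamseyIs (S d₁ d₂ d₃) (d₁ + d₂ + d₃ + 3))
proposition4p24 d₁ d₂ d₃ 1≤d₁ 1≤d₂ 1≤d₃ 3∣n = residues-one , residues-two , residues-zero-or-distinct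
  where open Theorem d₁ d₂ d₃ 1≤d₁ 1≤d₂ 1≤d₃ 3∣n
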